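{- Let $G$ be an $r$-regular simple graph with $n$ vertices, $m \neq 0$ edges, and let $\alpha \in [0,1)$. Then $$P_{A_\alpha(l(G))}(\lambda) = (\lambda - 2r\alpha + 2)^{m-n}(1-\alpha)^n\, P_{Q(G)}\!\left(\frac{\lambda - 2r\alpha + 2}{1-\alpha}\right).$$
   Context: For a square matrix $M$ of order $k$, $P_M(\lambda)=\det(\lambda I_k - M)$. For a simple graph $H$ with adjacency matrix $A(H)$ and diagonal degree matrix $D(H)$, and $\alpha\in[0,1]$, $A_\alpha(H)=\alpha D(H)+(1-\alpha)A(H)$, and $Q(H)=D(H)+A(H)$ is the signless Laplacian. The line graph $l(G)$ has the edges of $G$ as vertices, two being adjacent iff the corresponding edges share an endpoint. -}

module Defs where

open import Data.Nat as ℕ using (ℕ; zero; suc)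
open import Data.Fin using (Fin; zero; suc; punchIn; toℕ; _<_)
open import Data.Fin.Properties using (_≟_)
open import Data.Bool using (Bool; true; false; _∧_; _∨_; not; if_then_else_)
open import Data.Product using (_×_; _,_; proj₁; proj₂; ∃)
open import Relation.Nullary.Decidable using (⌊_⌋)
open import Relation.Binary.PropositionalEquality using (_≡_)
open import Algebra.Bundles using (CommutativeRing)
open import Function using (_∘_)
open import Function.Definitions using (Injective)

record SimpleGraph (n : ℕ) : Set where
  field
    adj    : Fin n → Fin n → Bool
    sym    : ∀ i j → adj i j ≡ adj j i
    irrefl : ∀ i → adj i i ≡ false
open SimpleGraph public

count : ∀ {k} → (Fin k → Bool) → ℕ
count {zero}  f = 0
count {suc k} f = (if f zero then 1 else 0) ℕ.+ count (f ∘ suc)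

degreeOf : ∀ {k} → (Fin k → Fin k → Bool) → Fin k → ℕ
degreeOf a v = count (a v)

IsRegular : ∀ {n} → SimpleGraph n → ℕ → Set
IsRegular G r = ∀ v → degreeOf (adj G) v ≡ r

-- An enumeration of the edge set of G by Fin m (a bijection between Fin m
-- and the set of pairs (u,v) with u < v and u ~ v).  Its existence means
-- that G has exactly m edges.
record EdgeEnumeration {n : ℕ} (G : SimpleGraph n) (m : ℕ) : Set where
  field
    edge       : Fin m → Fin n × Fin n
    ordered    : ∀ k → proj₁ (edge k) < proj₂ (edge k)
    isEdge     : ∀ k → adj G (proj₁ (edge k)) (proj₂ (edge k)) ≡ true
    injective  : Injective _≡_ _≡_ edge
    surjective : ∀ u v → u < v → adj G u v ≡ true → ∃ λ k → edge k ≡ (u , v)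
open EdgeEnumeration public

shares : ∀ {n} → Fin n × Fin n → Fin n × Fin n → Bool
shares (a , b) (c , d) = ⌊ a ≟ c ⌋ ∨ ⌊ a ≟ d ⌋ ∨ ⌊ b ≟ c ⌋ ∨ ⌊ b ≟ d ⌋

lineAdj : ∀ {n m} {G : SimpleGraph n} → EdgeEnumeration G m → Fin m → Fin m → Bool
lineAdj E k k' = not ⌊ k ≟ k' ⌋ ∧ shares (edge E k) (edge E k')

module Mat {c ℓ} (R : CommutativeRing c ℓ) where
  open CommutativeRing R using (Carrier; _+_; _*_; -_; 0#; 1#)

  Matrix : ℕ → Set c
  Matrix k = Fin k → Fin k → Carrier

  ℕ→R : ℕ → Carrier
  ℕ→R zero    = 0#
  ℕ→R (suc n) = 1# + ℕ→R n

  B→R : Bool → Carrier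
  B→R b = if b then 1# else 0#

  pow : Carrier → ℕ → Carrier
  pow x zero    = 1#
  pow x (suc n) = x * pow x n

  sumR : ∀ {k} → (Fin k → Carrier) → Carrier
  sumR {zero}  f = 0#
  sumR {suc k} f = f zero + sumR (f ∘ suc)

  sign : ℕ → Carrier
  sign zero    = 1#
  sign (suc j) = - sign j

  det : ∀ k → Matrix k → Carrier
  det zero    M = 1#
  det (suc k) M =
    sumR (λ j → sign (toℕ j) * M zero j * det k (λ a b → M (suc a) (punchIn j b)))

  I : ∀ {k} → Matrix k
  I i j = B→R ⌊ i ≟ j ⌋

  charPoly : ∀ {k} → Matrix k → Carrier → Carrier
  charPoly {k} M x = det k (λ i j → x * I i j + - M i j)

  A : ∀ {k} → (Fin k → Fin k → Bool) → Matrix k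
  A a i j = B→R (a i j)

  D : ∀ {k} → (Fin k → Fin k → Bool) → Matrix k
  D a i j = I i j * ℕ→R (degreeOf a i)

  Aα : ∀ {k} → Carrier → (Fin k → Fin k → Bool) → Matrix k
  Aα α a i j = α * D a i j + (1# + - α) * A a i j

  Q : ∀ {k} → (Fin k → Fin k → Bool) → Matrix k
  Q a i j = D a i j + A a i j

{-# OPTIONS --safe #-}
-- Let B be the n × m vertex-edge incidence matrix of G and β = 1 - α. Then B Bᵀ = Q(G),
-- Bᵀ B = A(l(G)) + 2I and l(G) is (2r - 2)-regular, so with y = λ - 2rα + 2
--   λI - A_α(l(G)) = yI - (βBᵀ) B   and   yI - B (βBᵀ) = β ((y/β) I - Q(G)).
-- The theorem is thus Sylvester's identity P_{KL}(y) = y^(m-n) P_{LK}(y) for n ≤ m, an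
-- n × m matrix L and an m × n matrix K. Column operations on the block matrix
-- [[yI, L], [K, I]] reduce its determinant to either Schur complement, which gives
-- y^m P_{LK}(y) = y^n P_{KL}(y) over every commutative ring. Cancelling y^n is only
-- legitimate when y is not a zero divisor, so the identity is proved in R[X] at the
-- indeterminate X and then evaluated at y.
module Submission where

open import Defs
open import Data.Nat using (ℕ; _≤_; _<_; _∸_)
open import Data.Product using (_×_)
open import Relation.Binary.PropositionalEquality using (_≢_)
open import Algebra.Bundles using (CommutativeRing)

import Algebra.Properties.Ring as RingProperties
open import Algebra.Morphism.Structures using (IsRingHomomorphism)
open import Algebra.Structures using (IsCommutativeRing)
open import Data.Bool using (Bool; true; false; if_then_else_)
open import Data.Fin as Fin using (Fin; zero; suc; toℕ; punchIn; punchOut; _↑ˡ_; _↑ʳ_; splitAt)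
open import Data.Fin.Properties as Fin
  using (_≟_; punchIn-punchOut; punchInᵢ≢i; punchIn-injective; ↑ˡ-injective; ↑ʳ-injective; splitAt-↑ˡ;
         splitAt-↑ʳ; splitAt⁻¹-↑ˡ; splitAt⁻¹-↑ʳ; toℕ-↑ˡ; toℕ-inject₁; toℕ-injective; suc-injective; 0≢1+n)
open import Data.List as List using (List; []; _∷_)
open import Data.Nat as ℕ using (zero; suc)
import Data.Nat.Properties as ℕ
open import Data.Product using (_,_; proj₁; proj₂)
open import Data.Sum using (_⊎_; inj₁; inj₂; [_,_]′)
open import Data.Vec.Functional using (updateAt)
open import Data.Vec.Functional.Properties using (updateAt-updates; updateAt-minimal)
open import Function using (_∘_)
open import Function.Definitions using (Injective)
open import Relation.Binary.Definitions using (tri<; tri≈; tri>)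
open import Relation.Binary.PropositionalEquality as ≡ using (_≡_)
open import Relation.Nullary using (¬_; yes; no; contradiction)

-- Algebra.Solver.Ring needs coefficients with decidable equality; the integers, interpreted
-- in R, serve for every commutative ring. The optimised multiplication _×′_ makes the
-- solver constants con (+ 0) and con (+ 1) evaluate to 0# and 1# themselves.
module IntegerCoefficientSolver {c ℓ} (R : CommutativeRing c ℓ) where
  import Algebra.Solver.Ring
  open import Algebra.Solver.Ring.AlmostCommutativeRing using (_-Raw-AlmostCommutative⟶_; fromCommutativeRing)
  open import Data.Integer as ℤ using (ℤ; +_; -[1+_]; _⊖_; _◃_; ∣_∣)
  import Data.Integer.Properties as ℤ
  import Data.Maybe as Maybe
  import Data.Sign as Sign
  open import Relation.Binary.Consequences using (dec⇒weaklyDec)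
  open CommutativeRing R renaming (sym to ≈-sym)
  open RingProperties ring using (-‿involutive; -0#≈0#; -‿+-comm; -1*x≈-x)
  open import Algebra.Properties.Semiring.Mult.TCOptimised semiring
    using (1+×; ×-homo-+; ×1-homo-*) renaming (_×_ to _×′_)
  open import Algebra.Properties.CommutativeSemigroup +-commutativeSemigroup
    using () renaming (interchange to +-interchange)
  open import Algebra.Properties.CommutativeSemigroup *-commutativeSemigroup
    using () renaming (interchange to *-interchange)
  open import Relation.Binary.Reasoning.Setoid setoid

  ℤ→R : ℤ → Carrier
  ℤ→R (+ n)    = n ×′ 1#
  ℤ→R -[1+ n ] = - (suc n ×′ 1#)

  ℤ→R-⊖ : ∀ m n → ℤ→R (m ⊖ n) ≈ m ×′ 1# + - (n ×′ 1#)
  ℤ→R-⊖ zero    zero    = ≈-sym (trans (+-identityˡ _) -0#≈0#)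
  ℤ→R-⊖ zero    (suc n) = ≈-sym (+-identityˡ _)
  ℤ→R-⊖ (suc m) zero    = ≈-sym (trans (+-congˡ -0#≈0#) (+-identityʳ _))
  ℤ→R-⊖ (suc m) (suc n) = begin
    ℤ→R (suc m ⊖ suc n)                     ≡⟨ ≡.cong ℤ→R (ℤ.[1+m]⊖[1+n]≡m⊖n m n) ⟩
    ℤ→R (m ⊖ n)                             ≈⟨ ℤ→R-⊖ m n ⟩
    m ×′ 1# + - (n ×′ 1#)                   ≈⟨ +-identityˡ _ ⟨
    0# + (m ×′ 1# + - (n ×′ 1#))            ≈⟨ +-congʳ (-‿inverseʳ 1#) ⟨
    (1# + - 1#) + (m ×′ 1# + - (n ×′ 1#))   ≈⟨ +-interchange _ _ _ _ ⟩
    (1# + m ×′ 1#) + (- 1# + - (n ×′ 1#))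
      ≈⟨ +-cong (1+× m 1#) (trans (-‿cong (1+× n 1#)) (≈-sym (-‿+-comm 1# _))) ⟨
    suc m ×′ 1# + - (suc n ×′ 1#)           ∎

  ℤ→R-+ : ∀ i j → ℤ→R (i ℤ.+ j) ≈ ℤ→R i + ℤ→R j
  ℤ→R-+ (+ m)    (+ n)    = ×-homo-+ 1# m n
  ℤ→R-+ (+ m)    -[1+ n ] = ℤ→R-⊖ m (suc n)
  ℤ→R-+ -[1+ m ] (+ n)    = trans (ℤ→R-⊖ n (suc m)) (+-comm _ _)
  ℤ→R-+ -[1+ m ] -[1+ n ] = begin
    - (suc (suc (m ℕ.+ n)) ×′ 1#)       ≡⟨ ≡.cong (λ k → - (suc k ×′ 1#)) (ℕ.+-suc m n) ⟨
    - ((suc m ℕ.+ suc n) ×′ 1#)         ≈⟨ -‿cong (×-homo-+ 1# (suc m) (suc n)) ⟩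
    - (suc m ×′ 1# + suc n ×′ 1#)       ≈⟨ -‿+-comm _ _ ⟨
    - (suc m ×′ 1#) + - (suc n ×′ 1#)   ∎

  ℤ→R-neg : ∀ i → ℤ→R (ℤ.- i) ≈ - ℤ→R i
  ℤ→R-neg (+ zero)  = ≈-sym -0#≈0#
  ℤ→R-neg (+ suc n) = refl
  ℤ→R-neg -[1+ n ]  = ≈-sym (-‿involutive _)

  signToR : Sign.Sign → Carrier
  signToR Sign.+ = 1#
  signToR Sign.- = - 1#

  signToR-* : ∀ s t → signToR (s Sign.* t) ≈ signToR s * signToR t
  signToR-* Sign.+ t      = ≈-sym (*-identityˡ _)
  signToR-* Sign.- Sign.+ = ≈-sym (*-identityʳ _)
  signToR-* Sign.- Sign.- = ≈-sym (trans (-1*x≈-x _) (-‿involutive _))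

  ℤ→R-◃ : ∀ s n → ℤ→R (s ◃ n) ≈ signToR s * (n ×′ 1#)
  ℤ→R-◃ s      zero    = ≈-sym (zeroʳ _)
  ℤ→R-◃ Sign.+ (suc n) = ≈-sym (*-identityˡ _)
  ℤ→R-◃ Sign.- (suc n) = ≈-sym (-1*x≈-x _)

  ℤ→R-signAbs : ∀ i → ℤ→R i ≈ signToR (ℤ.sign i) * (∣ i ∣ ×′ 1#)
  ℤ→R-signAbs (+ n)    = ≈-sym (*-identityˡ _)
  ℤ→R-signAbs -[1+ n ] = ≈-sym (-1*x≈-x _)

  ℤ→R-* : ∀ i j → ℤ→R (i ℤ.* j) ≈ ℤ→R i * ℤ→R j
  ℤ→R-* i j = begin
    ℤ→R (ℤ.sign i Sign.* ℤ.sign j ◃ ∣ i ∣ ℕ.* ∣ j ∣)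
      ≈⟨ ℤ→R-◃ (ℤ.sign i Sign.* ℤ.sign j) (∣ i ∣ ℕ.* ∣ j ∣) ⟩
    signToR (ℤ.sign i Sign.* ℤ.sign j) * ((∣ i ∣ ℕ.* ∣ j ∣) ×′ 1#)
      ≈⟨ *-cong (signToR-* (ℤ.sign i) (ℤ.sign j)) (×1-homo-* ∣ i ∣ ∣ j ∣) ⟩
    (signToR (ℤ.sign i) * signToR (ℤ.sign j)) * ((∣ i ∣ ×′ 1#) * (∣ j ∣ ×′ 1#))
      ≈⟨ *-interchange _ _ _ _ ⟩
    (signToR (ℤ.sign i) * (∣ i ∣ ×′ 1#)) * (signToR (ℤ.sign j) * (∣ j ∣ ×′ 1#))
      ≈⟨ *-cong (ℤ→R-signAbs i) (ℤ→R-signAbs j) ⟨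
    ℤ→R i * ℤ→R j ∎

  homomorphism : ℤ.+-*-rawRing -Raw-AlmostCommutative⟶ fromCommutativeRing R
  homomorphism = record
    { ⟦_⟧    = ℤ→R
    ; +-homo = ℤ→R-+
    ; *-homo = ℤ→R-*
    ; -‿homo = ℤ→R-neg
    ; 0-homo = refl
    ; 1-homo = refl
    }

  ℤ→R-≟ : ∀ i j → Maybe.Maybe (ℤ→R i ≈ ℤ→R j)
  ℤ→R-≟ i j = Maybe.map (reflexive ∘ ≡.cong ℤ→R) (dec⇒weaklyDec ℤ._≟_ i j)

  open Algebra.Solver.Ring ℤ.+-*-rawRing (fromCommutativeRing R) homomorphism ℤ→R-≟
    public using (solve; _:=_; _:+_; _:*_; :-_; con)

module Determinant {c ℓ} (R : CommutativeRing c ℓ) where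
  import Data.Integer as ℤ
  open CommutativeRing R hiding (zero) renaming (sym to ≈-sym)
  open Mat R
  open IntegerCoefficientSolver R using (solve; _:=_; _:+_; _:*_; :-_; con)
  open RingProperties ring using (-‿involutive; -0#≈0#; -‿distribˡ-*; +-inverseʳ-unique; -1*x≈-x)
  open import Algebra.Properties.Semiring.Sum semiring public
    using (sum; sum-cong-≋; sum-replicate-zero; ∑-distrib-+; ∑-comm; *-distribˡ-sum; *-distribʳ-sum; sum-remove)
  open import Algebra.Properties.Semiring.Mult semiring using (×-homo-+; ×1-homo-*) renaming (_×_ to _×′_)
  open import Relation.Binary.Reasoning.Setoid setoid

  sumR≡sum : ∀ {k} (f : Fin k → Carrier) → sumR f ≡ sum f
  sumR≡sum {zero}  f = ≡.refl
  sumR≡sum {suc k} f = ≡.cong (f zero +_) (sumR≡sum (f ∘ suc))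

  sum-zero : ∀ {k} (f : Fin k → Carrier) → (∀ i → f i ≈ 0#) → sum f ≈ 0#
  sum-zero {k} f f≈0 = trans (sum-cong-≋ f≈0) (sum-replicate-zero k)

  sum-↑ : ∀ n {m} (f : Fin (n ℕ.+ m) → Carrier) →
          sum f ≈ sum (λ i → f (i ↑ˡ m)) + sum (λ l → f (n ↑ʳ l))
  sum-↑ zero    f = ≈-sym (+-identityˡ _)
  sum-↑ (suc n) f = trans (+-congˡ (sum-↑ n (f ∘ suc))) (≈-sym (+-assoc _ _ _))

  sum-twoPoints : ∀ {k} {c d : Fin k} (f : Fin k → Carrier) → c ≢ d →
                  (∀ j → j ≢ c → j ≢ d → f j ≈ 0#) → sum f ≈ f c + f d
  sum-twoPoints {suc zero}    {zero} {zero} f c≢d _ = contradiction ≡.refl c≢d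
  sum-twoPoints {suc (suc k)} {c}    {d}    f c≢d others≈0 = begin
    sum f                                           ≈⟨ sum-remove {i = c} f ⟩
    f c + sum (f ∘ punchIn c)                       ≈⟨ +-congˡ (sum-remove {i = d′} (f ∘ punchIn c)) ⟩
    f c + (f (punchIn c d′) + sum (f ∘ punchIn c ∘ punchIn d′))
      ≈⟨ +-congˡ (+-cong (reflexive (≡.cong f (punchIn-punchOut c≢d))) (sum-zero _ rest≈0)) ⟩
    f c + (f d + 0#)                                ≈⟨ +-congˡ (+-identityʳ _) ⟩
    f c + f d                                       ∎
    where
    d′ = punchOut c≢d
    rest≈0 : ∀ b → f (punchIn c (punchIn d′ b)) ≈ 0#
    rest≈0 b = others≈0 _ (punchInᵢ≢i c _) λ eq →
      punchInᵢ≢i d′ b (punchIn-injective c _ _ (≡.trans eq (≡.sym (punchIn-punchOut c≢d))))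

  -‿sum : ∀ {k} (f : Fin k → Carrier) → - sum f ≈ sum (λ i → - f i)
  -‿sum f = begin
    - sum f                    ≈⟨ -1*x≈-x _ ⟨
    - 1# * sum f               ≈⟨ *-distribˡ-sum (- 1#) f ⟩
    sum (λ i → - 1# * f i)     ≈⟨ sum-cong-≋ (λ i → -1*x≈-x (f i)) ⟩
    sum (λ i → - f i)          ∎

  sum-cong : ∀ {k} (f g : Fin k → Carrier) → (∀ i → f i ≈ g i) → sum f ≈ sum g
  sum-cong f g = sum-cong-≋

  sum-linear : ∀ {k} a b (f g h : Fin k → Carrier) → (∀ i → f i ≈ a * g i + b * h i) →
               sum f ≈ a * sum g + b * sum h
  sum-linear a b f g h f≈ag+bh = begin
    sum f                                          ≈⟨ sum-cong f _ f≈ag+bh ⟩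
    sum (λ i → a * g i + b * h i)                  ≈⟨ ∑-distrib-+ (λ i → a * g i) (λ i → b * h i) ⟩
    sum (λ i → a * g i) + sum (λ i → b * h i)      ≈⟨ +-cong (*-distribˡ-sum a g) (*-distribˡ-sum b h) ⟨
    a * sum g + b * sum h                          ∎

  I-diag : ∀ {k} (i : Fin k) → I i i ≈ 1#
  I-diag i with i ≟ i
  ... | yes _   = refl
  ... | no i≢i = contradiction ≡.refl i≢i

  I-offDiag : ∀ {k} {i j : Fin k} → i ≢ j → I i j ≈ 0#
  I-offDiag {i = i} {j} i≢j with i ≟ j
  ... | yes i≡j = contradiction i≡j i≢j
  ... | no _    = refl

  I-sym : ∀ {k} (i j : Fin k) → I i j ≈ I j i
  I-sym i j with i ≟ j
  ... | yes ≡.refl = ≈-sym (I-diag i)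
  ... | no i≢j     = ≈-sym (I-offDiag (i≢j ∘ ≡.sym))

  I-suc : ∀ {k} (i j : Fin k) → I (suc i) (suc j) ≈ I i j
  I-suc i j with i ≟ j
  ... | yes _ = refl
  ... | no _  = refl

  sum-I* : ∀ {k} (c : Fin k) (f : Fin k → Carrier) → sum (λ j → I c j * f j) ≈ f c
  sum-I* {suc k} c f = begin
    sum (λ j → I c j * f j)                                  ≈⟨ sum-remove {i = c} (λ j → I c j * f j) ⟩
    I c c * f c + sum (λ b → I c (punchIn c b) * f (punchIn c b))
      ≈⟨ +-cong (*-congʳ (I-diag c))
                (sum-zero _ λ b → trans (*-congʳ (I-offDiag (punchInᵢ≢i c b ∘ ≡.sym))) (zeroˡ _)) ⟩
    1# * f c + 0#                                            ≈⟨ trans (+-identityʳ _) (*-identityˡ _) ⟩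
    f c                                                      ∎

  sum-*I : ∀ {k} (c : Fin k) (f : Fin k → Carrier) → sum (λ j → f j * I c j) ≈ f c
  sum-*I c f = trans (sum-cong (λ j → f j * I c j) (λ j → I c j * f j) (λ j → *-comm (f j) (I c j))) (sum-I* c f)

  sum-I-col : ∀ {k} (b : Fin k) → sum (λ a → I a b) ≈ 1#
  sum-I-col b = trans (sum-cong _ (λ a → 1# * I b a) λ a → trans (I-sym a b) (≈-sym (*-identityˡ _)))
                      (sum-*I b (λ _ → 1#))

  sum-I-*-I : ∀ {k} (a c : Fin k) → sum (λ v → I v a * I v c) ≈ I a c
  sum-I-*-I a c = trans (sum-cong _ (λ v → I a v * I v c) λ v → *-congʳ (I-sym v a)) (sum-I* a (λ v → I v c))

  I-*-I : ∀ {k} (i j a : Fin k) → I i a * I j a ≈ I i j * I i a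
  I-*-I i j a with i ≟ a
  ... | yes ≡.refl = trans (*-identityˡ _) (trans (I-sym j i) (≈-sym (*-identityʳ _)))
  ... | no _       = trans (zeroˡ _) (≈-sym (zeroʳ _))

  ℕ→R≡×1# : ∀ k → ℕ→R k ≡ k ×′ 1#
  ℕ→R≡×1# zero    = ≡.refl
  ℕ→R≡×1# (suc k) = ≡.cong (1# +_) (ℕ→R≡×1# k)

  ℕ→R-+ : ∀ k l → ℕ→R (k ℕ.+ l) ≈ ℕ→R k + ℕ→R l
  ℕ→R-+ k l rewrite ℕ→R≡×1# k | ℕ→R≡×1# l | ℕ→R≡×1# (k ℕ.+ l) = ×-homo-+ 1# k l

  ℕ→R-* : ∀ k l → ℕ→R (k ℕ.* l) ≈ ℕ→R k * ℕ→R l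
  ℕ→R-* k l rewrite ℕ→R≡×1# k | ℕ→R≡×1# l | ℕ→R≡×1# (k ℕ.* l) = ×1-homo-* k l

  ℕ→R-count : ∀ {k} (f : Fin k → Bool) → ℕ→R (count f) ≈ sum (λ j → B→R (f j))
  ℕ→R-count {zero}  f = refl
  ℕ→R-count {suc k} f = trans (ℕ→R-+ (if f zero then 1 else 0) (count (f ∘ suc)))
                              (+-cong (indicator (f zero)) (ℕ→R-count (f ∘ suc)))
    where
    indicator : ∀ b → ℕ→R (if b then 1 else 0) ≈ B→R b
    indicator true  = +-identityʳ 1#
    indicator false = refl

  pow-+ : ∀ x m n → pow x (m ℕ.+ n) ≈ pow x m * pow x n
  pow-+ x zero    n = ≈-sym (*-identityˡ _)
  pow-+ x (suc m) n = trans (*-congˡ (pow-+ x m n)) (≈-sym (*-assoc _ _ _))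

  pow-1# : ∀ n → pow 1# n ≈ 1#
  pow-1# zero    = refl
  pow-1# (suc n) = trans (*-identityˡ _) (pow-1# n)

  minor : ∀ {k} → Fin (suc k) → Matrix (suc k) → Matrix k
  minor j M a b = M (suc a) (punchIn j b)

  laplaceTerm : ∀ {k} → Matrix (suc k) → Fin (suc k) → Carrier
  laplaceTerm {k} M j = sign (toℕ j) * M zero j * det k (minor j M)

  det-laplace : ∀ {k} (M : Matrix (suc k)) → det (suc k) M ≈ sum (laplaceTerm M)
  det-laplace M = reflexive (sumR≡sum (laplaceTerm M))

  det-cong : ∀ {k} {M N : Matrix k} → (∀ i j → M i j ≈ N i j) → det k M ≈ det k N
  det-cong {zero}  _   = refl
  det-cong {suc k} {M} {N} M≈N = begin
    det (suc k) M        ≈⟨ det-laplace M ⟩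
    sum (laplaceTerm M)  ≈⟨ sum-cong (laplaceTerm M) (laplaceTerm N) (λ j →
                              *-cong (*-congˡ (M≈N zero j)) (det-cong (λ a b → M≈N (suc a) (punchIn j b)))) ⟩
    sum (laplaceTerm N)  ≈⟨ det-laplace N ⟨
    det (suc k) N        ∎

  det-scale : ∀ k a (M : Matrix k) → det k (λ i j → a * M i j) ≈ pow a k * det k M
  det-scale zero    a M = ≈-sym (*-identityˡ _)
  det-scale (suc k) a M = begin
    det (suc k) aM                                   ≈⟨ det-laplace aM ⟩
    sum (laplaceTerm aM)
      ≈⟨ sum-cong (laplaceTerm aM) (λ j → (a * pow a k) * laplaceTerm M j) scaled-term ⟩
    sum (λ j → (a * pow a k) * laplaceTerm M j)      ≈⟨ *-distribˡ-sum (a * pow a k) (laplaceTerm M) ⟨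
    a * pow a k * sum (laplaceTerm M)                ≈⟨ *-congˡ (det-laplace M) ⟨
    a * pow a k * det (suc k) M                      ∎
    where
    aM : Matrix (suc k)
    aM i j = a * M i j
    scaled-term : ∀ j → laplaceTerm aM j ≈ (a * pow a k) * laplaceTerm M j
    scaled-term j = begin
      sign (toℕ j) * (a * M zero j) * det k (minor j aM)
        ≈⟨ *-congˡ (det-scale k a (minor j M)) ⟩
      sign (toℕ j) * (a * M zero j) * (pow a k * det k (minor j M))
        ≈⟨ solve 5 (λ s a x p d → s :* (a :* x) :* (p :* d) := (a :* p) :* (s :* x :* d)) refl
                   (sign (toℕ j)) a (M zero j) (pow a k) (det k (minor j M)) ⟩
      (a * pow a k) * laplaceTerm M j ∎

  charPoly-cong : ∀ {k} {M N : Matrix k} {x y} → (∀ i j → M i j ≈ N i j) → x ≈ y → charPoly M x ≈ charPoly N y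
  charPoly-cong M≈N x≈y = det-cong λ i j → +-cong (*-congʳ x≈y) (-‿cong (M≈N i j))

  det-zero-row : ∀ {k} (M : Matrix k) (r : Fin k) → (∀ j → M r j ≈ 0#) → det k M ≈ 0#
  det-zero-row {suc k} M zero    row≈0 = trans (det-laplace M) (sum-zero (laplaceTerm M) λ j →
    trans (*-congʳ (trans (*-congˡ (row≈0 j)) (zeroʳ _))) (zeroˡ _))
  det-zero-row {suc k} M (suc r) row≈0 = trans (det-laplace M) (sum-zero (laplaceTerm M) λ j →
    trans (*-congˡ (det-zero-row (minor j M) r (row≈0 ∘ punchIn j))) (zeroʳ _))

  AgreeOffCol : ∀ {k} → Fin k → Matrix k → Matrix k → Set ℓ
  AgreeOffCol c M N = ∀ i j → j ≢ c → M i j ≈ N i j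

  minor-agreeOffCol : ∀ {k} {j c : Fin (suc k)} {M N : Matrix (suc k)} (j≢c : j ≢ c) →
                      AgreeOffCol c M N → AgreeOffCol (punchOut j≢c) (minor j M) (minor j N)
  minor-agreeOffCol {j = j} j≢c M≈N a b b≢c′ = M≈N (suc a) (punchIn j b) λ eq →
    b≢c′ (punchIn-injective j _ _ (≡.trans eq (≡.sym (punchIn-punchOut j≢c))))

  minor-agreeAtCol : ∀ {k} {c : Fin (suc k)} {M N : Matrix (suc k)} →
                     AgreeOffCol c M N → ∀ a b → minor c M a b ≈ minor c N a b
  minor-agreeAtCol {c = c} M≈N a b = M≈N (suc a) (punchIn c b) (punchInᵢ≢i c b)

  det-linear-col : ∀ {k} {c : Fin k} {M N₁ N₂ : Matrix k} (a b : Carrier) →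
                   AgreeOffCol c M N₁ → AgreeOffCol c M N₂ →
                   (∀ i → M i c ≈ a * N₁ i c + b * N₂ i c) →
                   det k M ≈ a * det k N₁ + b * det k N₂
  det-linear-col {suc k} {c} {M} {N₁} {N₂} a b M≈N₁ M≈N₂ colc = begin
    det (suc k) M                                    ≈⟨ det-laplace M ⟩
    sum (laplaceTerm M)
      ≈⟨ sum-linear a b _ (laplaceTerm N₁) (laplaceTerm N₂) term-linear ⟩
    a * sum (laplaceTerm N₁) + b * sum (laplaceTerm N₂)
      ≈⟨ +-cong (*-congˡ (det-laplace N₁)) (*-congˡ (det-laplace N₂)) ⟨
    a * det (suc k) N₁ + b * det (suc k) N₂          ∎
    where
    term-linear : ∀ j → laplaceTerm M j ≈ a * laplaceTerm N₁ j + b * laplaceTerm N₂ j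
    term-linear j with j ≟ c
    ... | yes ≡.refl = begin
      s * M zero j * det k (minor j M)                     ≈⟨ *-congʳ (*-congˡ (colc zero)) ⟩
      s * (a * N₁ zero j + b * N₂ zero j) * det k (minor j M)
        ≈⟨ solve 6 (λ s a x b y d → s :* (a :* x :+ b :* y) :* d := a :* (s :* x :* d) :+ b :* (s :* y :* d))
                   refl s a (N₁ zero j) b (N₂ zero j) (det k (minor j M)) ⟩
      a * (s * N₁ zero j * det k (minor j M)) + b * (s * N₂ zero j * det k (minor j M))
        ≈⟨ +-cong (*-congˡ (*-congˡ (det-cong (minor-agreeAtCol M≈N₁))))
                  (*-congˡ (*-congˡ (det-cong (minor-agreeAtCol M≈N₂)))) ⟩
      a * laplaceTerm N₁ j + b * laplaceTerm N₂ j          ∎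
      where s = sign (toℕ j)
    ... | no j≢c = begin
      s * M zero j * det k (minor j M)                     ≈⟨ *-congˡ minors-linear ⟩
      s * M zero j * (a * det k (minor j N₁) + b * det k (minor j N₂))
        ≈⟨ solve 6 (λ s x a d b e → s :* x :* (a :* d :+ b :* e) := a :* (s :* x :* d) :+ b :* (s :* x :* e))
                   refl s (M zero j) a (det k (minor j N₁)) b (det k (minor j N₂)) ⟩
      a * (s * M zero j * det k (minor j N₁)) + b * (s * M zero j * det k (minor j N₂))
        ≈⟨ +-cong (*-congˡ (*-congʳ (*-congˡ (M≈N₁ zero j j≢c))))
                  (*-congˡ (*-congʳ (*-congˡ (M≈N₂ zero j j≢c)))) ⟩
      a * laplaceTerm N₁ j + b * laplaceTerm N₂ j          ∎
      where
      s = sign (toℕ j)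
      minors-linear : det k (minor j M) ≈ a * det k (minor j N₁) + b * det k (minor j N₂)
      minors-linear = det-linear-col a b (minor-agreeOffCol j≢c M≈N₁) (minor-agreeOffCol j≢c M≈N₂) λ i →
        ≡.subst (λ col → M (suc i) col ≈ a * N₁ (suc i) col + b * N₂ (suc i) col)
                (≡.sym (punchIn-punchOut j≢c)) (colc (suc i))

  det-zero-col : ∀ {k} (M : Matrix k) (c : Fin k) → (∀ i → M i c ≈ 0#) → det k M ≈ 0#
  det-zero-col M c col≈0 = begin
    det _ M                      ≈⟨ det-linear-col 0# 0# (λ _ _ _ → refl) (λ _ _ _ → refl) col≈0·col+0·col ⟩
    0# * det _ M + 0# * det _ M  ≈⟨ +-cong (zeroˡ _) (zeroˡ _) ⟩
    0# + 0#                      ≈⟨ +-identityˡ 0# ⟩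
    0#                           ∎
    where
    col≈0·col+0·col : ∀ i → M i c ≈ 0# * M i c + 0# * M i c
    col≈0·col+0·col i = trans (col≈0 i) (≈-sym (trans (+-cong (zeroˡ _) (zeroˡ _)) (+-identityˡ 0#)))

  det-additive-col : ∀ {k} {c : Fin k} {M N₁ N₂ : Matrix k} →
                     AgreeOffCol c M N₁ → AgreeOffCol c M N₂ → (∀ i → M i c ≈ N₁ i c + N₂ i c) →
                     det k M ≈ det k N₁ + det k N₂
  det-additive-col M≈N₁ M≈N₂ colc =
    trans (det-linear-col 1# 1# M≈N₁ M≈N₂ (λ i → trans (colc i) (≈-sym (+-cong (*-identityˡ _) (*-identityˡ _)))))
          (+-cong (*-identityˡ _) (*-identityˡ _))

  infixl 9 _[_]≔_
  _[_]≔_ : ∀ {k} → Matrix k → Fin k → (Fin k → Carrier) → Matrix k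
  (M [ c ]≔ v) i = updateAt (M i) c (λ _ → v i)

  replaceCol-at : ∀ {k} (M : Matrix k) c v i → (M [ c ]≔ v) i c ≡ v i
  replaceCol-at M c v i = updateAt-updates c (M i)

  replaceCol-off : ∀ {k} (M : Matrix k) {c j} v i → j ≢ c → (M [ c ]≔ v) i j ≡ M i j
  replaceCol-off M v i j≢c = updateAt-minimal _ _ (M i) j≢c

  replaceCol-agreeOffCol : ∀ {k} (M : Matrix k) c u v → AgreeOffCol c (M [ c ]≔ u) (M [ c ]≔ v)
  replaceCol-agreeOffCol M c u v i j j≢c =
    reflexive (≡.trans (replaceCol-off M u i j≢c) (≡.sym (replaceCol-off M v i j≢c)))

  adjacent⇒≢ : ∀ {k} {c d : Fin k} → toℕ d ≡ suc (toℕ c) → c ≢ d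
  adjacent⇒≢ d=c+1 c≡d = ℕ.1+n≢n (≡.sym (≡.trans (≡.cong toℕ c≡d) d=c+1))

  punchIn-adjacent : ∀ {k} {c d : Fin (suc k)} → toℕ d ≡ suc (toℕ c) → ∀ b →
                     punchIn c b ≡ punchIn d b ⊎ (punchIn c b ≡ d × punchIn d b ≡ c)
  punchIn-adjacent {c = zero}  {zero}        ()
  punchIn-adjacent {c = zero}  {suc zero}    _  zero    = inj₂ (≡.refl , ≡.refl)
  punchIn-adjacent {c = zero}  {suc zero}    _  (suc b) = inj₁ ≡.refl
  punchIn-adjacent {c = zero}  {suc (suc d)} ()
  punchIn-adjacent {c = suc c} {zero}        ()
  punchIn-adjacent {c = suc c} {suc d}       _  zero    = inj₁ ≡.refl
  punchIn-adjacent {c = suc c} {suc d}       d=c+1 (suc b) with punchIn-adjacent (ℕ.suc-injective d=c+1) b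
  ... | inj₁ eq            = inj₁ (≡.cong suc eq)
  ... | inj₂ (eq₁ , eq₂)   = inj₂ (≡.cong suc eq₁ , ≡.cong suc eq₂)

  punchOut-adjacent : ∀ {k} {j c d : Fin (suc k)} → toℕ d ≡ suc (toℕ c) → (j≢c : j ≢ c) (j≢d : j ≢ d) →
                      toℕ (punchOut j≢d) ≡ suc (toℕ (punchOut j≢c))
  punchOut-adjacent {_}           {zero}        {zero}  {_}           _     j≢c _   = contradiction ≡.refl j≢c
  punchOut-adjacent {_}           {zero}        {suc c} {zero}        ()
  punchOut-adjacent {_}           {zero}        {suc c} {suc d}       d=c+1 _   _   = ℕ.suc-injective d=c+1
  punchOut-adjacent {_}           {suc j}       {zero}  {zero}        ()
  punchOut-adjacent {_}           {suc zero}    {zero}  {suc zero}    _     _   j≢d = contradiction ≡.refl j≢d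
  punchOut-adjacent {suc (suc _)} {suc (suc j)} {zero}  {suc zero}    _     _   _   = ≡.refl
  punchOut-adjacent {_}           {suc j}       {zero}  {suc (suc d)} ()
  punchOut-adjacent {_}           {suc j}       {suc c} {zero}        ()
  punchOut-adjacent {suc k}       {suc j}       {suc c} {suc d}       d=c+1 j≢c j≢d =
    ≡.cong suc (punchOut-adjacent (ℕ.suc-injective d=c+1) (j≢c ∘ ≡.cong suc) (j≢d ∘ ≡.cong suc))

  minor-col : ∀ {k} (M : Matrix (suc k)) {j c : Fin (suc k)} (j≢c : j ≢ c) a →
              minor j M a (punchOut j≢c) ≡ M (suc a) c
  minor-col M j≢c a = ≡.cong (M (suc a)) (punchIn-punchOut j≢c)

  -- In the expansion along the first row, every minor except those at c and d has two equal
  -- adjacent columns, and the terms at c and d cancel.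
  det-equal-adjacent-cols : ∀ {k} (M : Matrix k) {c d : Fin k} → toℕ d ≡ suc (toℕ c) →
                            (∀ i → M i c ≈ M i d) → det k M ≈ 0#
  det-equal-adjacent-cols {suc k} M {c} {d} d=c+1 c≈d = begin
    det _ M                            ≈⟨ det-laplace M ⟩
    sum (laplaceTerm M)                ≈⟨ sum-twoPoints (laplaceTerm M) c≢d other-terms≈0 ⟩
    laplaceTerm M c + laplaceTerm M d
      ≈⟨ +-congˡ (*-cong (*-cong (reflexive (≡.cong sign d=c+1)) (≈-sym (c≈d zero)))
                        (det-cong (λ a b → ≈-sym (minors-equal a b)))) ⟩
    s * x * δ + - s * x * δ
      ≈⟨ solve 3 (λ s x δ → s :* x :* δ :+ :- s :* x :* δ := con (ℤ.+ 0)) refl s x δ ⟩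
    0#                                 ∎
    where
    s = sign (toℕ c)
    x = M zero c
    δ = det k (minor c M)
    c≢d = adjacent⇒≢ d=c+1
    other-terms≈0 : ∀ j → j ≢ c → j ≢ d → laplaceTerm M j ≈ 0#
    other-terms≈0 j j≢c j≢d =
      trans (*-congˡ (det-equal-adjacent-cols (minor j M) (punchOut-adjacent d=c+1 j≢c j≢d) cols)) (zeroʳ _)
      where
      cols : ∀ a → minor j M a (punchOut j≢c) ≈ minor j M a (punchOut j≢d)
      cols a = trans (reflexive (minor-col M j≢c a)) (trans (c≈d (suc a)) (reflexive (≡.sym (minor-col M j≢d a))))
    minors-equal : ∀ a b → minor c M a b ≈ minor d M a b
    minors-equal a b with punchIn-adjacent d=c+1 b
    ... | inj₁ eq          = reflexive (≡.cong (M (suc a)) eq)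
    ... | inj₂ (eq₁ , eq₂) = trans (reflexive (≡.cong (M (suc a)) eq₁))
                               (trans (≈-sym (c≈d (suc a))) (reflexive (≡.cong (M (suc a)) (≡.sym eq₂))))

  module ColumnPair {k} (M : Matrix k) {c d : Fin k} (c≢d : c ≢ d) where

    col : Fin k → Fin k → Carrier
    col j i = M i j

    replacePair : (Fin k → Carrier) → (Fin k → Carrier) → Matrix k
    replacePair u v = M [ c ]≔ u [ d ]≔ v

    replacePair-c : ∀ u v i → replacePair u v i c ≡ u i
    replacePair-c u v i = ≡.trans (replaceCol-off (M [ c ]≔ u) v i c≢d) (replaceCol-at M c u i)

    replacePair-d : ∀ u v i → replacePair u v i d ≡ v i
    replacePair-d u v i = replaceCol-at (M [ c ]≔ u) d v i

    replacePair-off : ∀ u v i {j} → j ≢ c → j ≢ d → replacePair u v i j ≡ M i j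
    replacePair-off u v i j≢c j≢d = ≡.trans (replaceCol-off (M [ c ]≔ u) v i j≢d) (replaceCol-off M u i j≢c)

    replacePair-self : ∀ i j → M i j ≈ replacePair (col c) (col d) i j
    replacePair-self i j with j ≟ c | j ≟ d
    ... | yes ≡.refl | _          = reflexive (≡.sym (replacePair-c (col c) (col d) i))
    ... | no _       | yes ≡.refl = reflexive (≡.sym (replacePair-d (col c) (col d) i))
    ... | no j≢c     | no j≢d     = reflexive (≡.sym (replacePair-off (col c) (col d) i j≢c j≢d))

    det-replacePair-additiveˡ : ∀ u₁ u₂ v → det k (replacePair (λ i → u₁ i + u₂ i) v)
                                            ≈ det k (replacePair u₁ v) + det k (replacePair u₂ v)
    det-replacePair-additiveˡ u₁ u₂ v = det-additive-col {c = c} (agree u₁) (agree u₂) λ i →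
      reflexive (≡.trans (replacePair-c u₁+u₂ v i) (≡.sym (≡.cong₂ _+_ (replacePair-c u₁ v i) (replacePair-c u₂ v i))))
      where
      u₁+u₂ : Fin k → Carrier
      u₁+u₂ i = u₁ i + u₂ i
      agree : ∀ u → AgreeOffCol c (replacePair u₁+u₂ v) (replacePair u v)
      agree u i j j≢c with j ≟ d
      ... | yes ≡.refl = reflexive (≡.trans (replacePair-d u₁+u₂ v i) (≡.sym (replacePair-d u v i)))
      ... | no j≢d     = reflexive (≡.trans (replacePair-off u₁+u₂ v i j≢c j≢d) (≡.sym (replacePair-off u v i j≢c j≢d)))

    det-replacePair-additiveʳ : ∀ u v₁ v₂ → det k (replacePair u (λ i → v₁ i + v₂ i))
                                            ≈ det k (replacePair u v₁) + det k (replacePair u v₂)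
    det-replacePair-additiveʳ u v₁ v₂ = det-additive-col {c = d}
      (replaceCol-agreeOffCol (M [ c ]≔ u) d v₁+v₂ v₁) (replaceCol-agreeOffCol (M [ c ]≔ u) d v₁+v₂ v₂) λ i →
      reflexive (≡.trans (replacePair-d u v₁+v₂ i) (≡.sym (≡.cong₂ _+_ (replacePair-d u v₁ i) (replacePair-d u v₂ i))))
      where
      v₁+v₂ : Fin k → Carrier
      v₁+v₂ i = v₁ i + v₂ i

  -- (u , v) ↦ det (replacePair u v) is additive in both arguments and vanishes when u = v.
  det-swap-adjacent-cols : ∀ {k} (M : Matrix k) {c d : Fin k} (d=c+1 : toℕ d ≡ suc (toℕ c)) →
                           let open ColumnPair M (adjacent⇒≢ d=c+1) in
                           det k (replacePair (col d) (col c)) ≈ - det k M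
  det-swap-adjacent-cols {k} M {c} {d} d=c+1 = +-inverseʳ-unique _ _ (begin
    det k M + det k (X b a)                            ≈⟨ +-congʳ (det-cong replacePair-self) ⟩
    det k (X a b) + det k (X b a)                      ≈⟨ +-cong (+-identityˡ _) (+-identityʳ _) ⟨
    (0# + det k (X a b)) + (det k (X b a) + 0#)
      ≈⟨ +-cong (+-congʳ (X-diag≈0 a)) (+-congˡ (X-diag≈0 b)) ⟨
    (det k (X a a) + det k (X a b)) + (det k (X b a) + det k (X b b))
      ≈⟨ +-cong (det-replacePair-additiveʳ a a b) (det-replacePair-additiveʳ b a b) ⟨
    det k (X a a+b) + det k (X b a+b)                  ≈⟨ det-replacePair-additiveˡ a b a+b ⟨
    det k (X a+b a+b)                                  ≈⟨ X-diag≈0 a+b ⟩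
    0#                                                 ∎)
    where
    open ColumnPair M (adjacent⇒≢ d=c+1) renaming (replacePair to X)
    a b a+b : Fin k → Carrier
    a = col c
    b = col d
    a+b i = a i + b i
    X-diag≈0 : ∀ u → det k (X u u) ≈ 0#
    X-diag≈0 u = det-equal-adjacent-cols (X u u) d=c+1 λ i →
      reflexive (≡.trans (replacePair-c u u i) (≡.sym (replacePair-d u u i)))

  -- Swapping column d with its left neighbour moves the repeated column one step closer to c.
  det-equal-cols-at-distance : ∀ g {k} (M : Matrix k) {c d : Fin k} → toℕ d ≡ suc (toℕ c ℕ.+ g) →
                               (∀ i → M i c ≈ M i d) → det k M ≈ 0#
  det-equal-cols-at-distance zero    M d=c+1 c≈d =
    det-equal-adjacent-cols M (≡.trans d=c+1 (≡.cong suc (ℕ.+-identityʳ _))) c≈d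
  det-equal-cols-at-distance (suc g) M {c} {suc e} d=c+g+2 c≈d = begin
    det _ M           ≈⟨ -‿involutive _ ⟨
    - - det _ M       ≈⟨ -‿cong (det-swap-adjacent-cols M d=e+1) ⟨
    - det _ N         ≈⟨ -‿cong (det-equal-cols-at-distance g N e=c+g+1 c≈e) ⟩
    - 0#              ≈⟨ -0#≈0# ⟩
    0#                ∎
    where
    e′ = Fin.inject₁ e
    d=e+1 : toℕ (suc e) ≡ suc (toℕ e′)
    d=e+1 = ≡.cong suc (≡.sym (toℕ-inject₁ e))
    e=c+g+1 : toℕ e′ ≡ suc (toℕ c ℕ.+ g)
    e=c+g+1 = ≡.trans (toℕ-inject₁ e) (≡.trans (ℕ.suc-injective d=c+g+2) (ℕ.+-suc (toℕ c) g))
    open ColumnPair M (adjacent⇒≢ d=e+1)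
    N = replacePair (col (suc e)) (col e′)
    c≈e : ∀ i → N i c ≈ N i e′
    c≈e i = begin
      N i c         ≡⟨ replacePair-off (col (suc e)) (col e′) i
                         (λ c≡e → ℕ.m≢1+m+n (toℕ c) (≡.trans (≡.cong toℕ c≡e) e=c+g+1))
                         (λ c≡d → ℕ.m≢1+m+n (toℕ c) (≡.trans (≡.cong toℕ c≡d) d=c+g+2)) ⟩
      M i c         ≈⟨ c≈d i ⟩
      M i (suc e)   ≡⟨ replacePair-c (col (suc e)) (col e′) i ⟨
      N i e′        ∎

  det-equal-cols : ∀ {k} (M : Matrix k) {c d : Fin k} → c ≢ d → (∀ i → M i c ≈ M i d) → det k M ≈ 0#
  det-equal-cols M {c} {d} c≢d c≈d with ℕ.<-cmp (toℕ c) (toℕ d)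
  ... | tri< c<d _ _ = det-equal-cols-at-distance _ M (≡.sym (ℕ.m+[n∸m]≡n c<d)) c≈d
  ... | tri≈ _ c≡d _ = contradiction (toℕ-injective c≡d) c≢d
  ... | tri> _ _ d<c = det-equal-cols-at-distance _ M (≡.sym (ℕ.m+[n∸m]≡n d<c)) (λ i → ≈-sym (c≈d i))

  det-col-combination : ∀ {k q} (M : Matrix k) (c : Fin k) (w : Fin q → Carrier) (g : Fin q → Fin k → Carrier) →
                        det k (M [ c ]≔ (λ i → sum (λ l → w l * g l i))) ≈ sum (λ l → w l * det k (M [ c ]≔ g l))
  det-col-combination {q = zero}  M c w g = det-zero-col _ c (λ i → reflexive (replaceCol-at M c _ i))
  det-col-combination {q = suc q} M c w g = begin
    det _ (M [ c ]≔ V)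
      ≈⟨ det-linear-col (w zero) 1# (replaceCol-agreeOffCol M c V (g zero)) (replaceCol-agreeOffCol M c V V′) colV ⟩
    w zero * det _ (M [ c ]≔ g zero) + 1# * det _ (M [ c ]≔ V′)
      ≈⟨ +-congˡ (trans (*-identityˡ _) (det-col-combination M c (w ∘ suc) (g ∘ suc))) ⟩
    sum (λ l → w l * det _ (M [ c ]≔ g l)) ∎
    where
    V V′ : Fin _ → Carrier
    V  i = sum (λ l → w l * g l i)
    V′ i = sum (λ l → w (suc l) * g (suc l) i)
    colV : ∀ i → (M [ c ]≔ V) i c ≈ w zero * (M [ c ]≔ g zero) i c + 1# * (M [ c ]≔ V′) i c
    colV i = begin
      (M [ c ]≔ V) i c                ≡⟨ replaceCol-at M c V i ⟩
      w zero * g zero i + V′ i        ≈⟨ +-congˡ (*-identityˡ _) ⟨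
      w zero * g zero i + 1# * V′ i
        ≡⟨ ≡.cong₂ (λ x y → w zero * x + 1# * y) (replaceCol-at M c (g zero) i) (replaceCol-at M c V′ i) ⟨
      w zero * (M [ c ]≔ g zero) i c + 1# * (M [ c ]≔ V′) i c ∎

  det-add-col-combination : ∀ {k q} {M N : Matrix k} {c : Fin k} (a : Carrier) (w : Fin q → Carrier) (src : Fin q → Fin k) →
                            (∀ l → src l ≢ c) → AgreeOffCol c N M →
                            (∀ i → N i c ≈ a * M i c + sum (λ l → w l * M i (src l))) → det k N ≈ a * det k M
  det-add-col-combination {k} {M = M} {N} {c} a w src src≢c N≈M colN = begin
    det k N
      ≈⟨ det-linear-col a 1# N≈M N≈M[c]≔V colN′ ⟩
    a * det k M + 1# * det k (M [ c ]≔ V)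
      ≈⟨ +-congˡ (*-congˡ (det-col-combination M c w srcCol)) ⟩
    a * det k M + 1# * sum (λ l → w l * det k (M [ c ]≔ srcCol l))
      ≈⟨ +-congˡ (*-congˡ (sum-zero _ λ l → trans (*-congˡ (repeated-col≈0 l)) (zeroʳ _))) ⟩
    a * det k M + 1# * 0#
      ≈⟨ trans (+-congˡ (zeroʳ 1#)) (+-identityʳ _) ⟩
    a * det k M ∎
    where
    srcCol : Fin _ → Fin k → Carrier
    srcCol l i = M i (src l)
    V : Fin k → Carrier
    V i = sum (λ l → w l * srcCol l i)
    N≈M[c]≔V : AgreeOffCol c N (M [ c ]≔ V)
    N≈M[c]≔V i j j≢c = trans (N≈M i j j≢c) (reflexive (≡.sym (replaceCol-off M V i j≢c)))
    colN′ : ∀ i → N i c ≈ a * M i c + 1# * (M [ c ]≔ V) i c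
    colN′ i = trans (colN i) (+-congˡ (≈-sym (trans (*-identityˡ _) (reflexive (replaceCol-at M c V i)))))
    repeated-col≈0 : ∀ l → det k (M [ c ]≔ srcCol l) ≈ 0#
    repeated-col≈0 l = det-equal-cols _ (src≢c l ∘ ≡.sym) λ i →
      reflexive (≡.trans (replaceCol-at M c (srcCol l) i) (≡.sym (replaceCol-off M (srcCol l) i (src≢c l))))

  -- Restoring the first target column of N to that of M gives a matrix covered by the
  -- induction hypothesis, from which N differs by a single column operation.
  det-add-col-combinations : ∀ {k p q} {M N : Matrix k} (a : Carrier) (tgt : Fin p → Fin k) (src : Fin q → Fin k)
                             (w : Fin p → Fin q → Carrier) → Injective _≡_ _≡_ tgt → (∀ e l → src l ≢ tgt e) →
                             (∀ i j → (∀ e → j ≢ tgt e) → N i j ≈ M i j) →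
                             (∀ i e → N i (tgt e) ≈ a * M i (tgt e) + sum (λ l → w e l * M i (src l))) →
                             det k N ≈ pow a p * det k M
  det-add-col-combinations {p = zero} a tgt src w _ _ untouched _ =
    trans (det-cong λ i j → untouched i j λ ()) (≈-sym (*-identityˡ _))
  det-add-col-combinations {k} {suc p} {M = M} {N} a tgt src w tgt-injective src≢tgt untouched combination = begin
    det k N                     ≈⟨ det-add-col-combination a (w zero) src (λ l → src≢tgt zero l) N≈N′ colN ⟩
    a * det k N′                ≈⟨ *-congˡ (det-add-col-combinations a (tgt ∘ suc) src (w ∘ suc)
                                     (suc-injective ∘ tgt-injective) (src≢tgt ∘ suc) untouched′ combination′) ⟩
    a * (pow a p * det k M)     ≈⟨ *-assoc _ _ _ ⟨
    pow a (suc p) * det k M     ∎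
    where
    t₀ = tgt zero
    colM : Fin k → Carrier
    colM i = M i t₀
    N′ : Matrix k
    N′ = N [ t₀ ]≔ colM
    N′-off : ∀ i {j} → j ≢ t₀ → N′ i j ≡ N i j
    N′-off i = replaceCol-off N colM i
    N≈N′ : AgreeOffCol t₀ N N′
    N≈N′ i j j≢t₀ = reflexive (≡.sym (N′-off i j≢t₀))
    colN : ∀ i → N i t₀ ≈ a * N′ i t₀ + sum (λ l → w zero l * N′ i (src l))
    colN i = trans (combination i zero) (+-cong (*-congˡ (reflexive (≡.sym (replaceCol-at N t₀ colM i))))
      (sum-cong _ _ λ l → *-congˡ (≈-sym (trans (reflexive (N′-off i (src≢tgt zero l)))
                                                  (untouched i (src l) (λ e → src≢tgt e l))))))
    untouched′ : ∀ i j → (∀ e → j ≢ tgt (suc e)) → N′ i j ≈ M i j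
    untouched′ i j j≢tgt with j ≟ t₀
    ... | yes ≡.refl = reflexive (replaceCol-at N t₀ colM i)
    ... | no j≢t₀    = trans (reflexive (N′-off i j≢t₀)) (untouched i j λ { zero → j≢t₀ ; (suc e) → j≢tgt e })
    combination′ : ∀ i e → N′ i (tgt (suc e)) ≈ a * M i (tgt (suc e)) + sum (λ l → w (suc e) l * M i (src l))
    combination′ i e = trans (reflexive (N′-off i λ eq → 0≢1+n (≡.sym (tgt-injective eq)))) (combination i (suc e))

  det-scalar : ∀ k y → det k (λ i j → y * I i j) ≈ pow y k
  det-scalar zero    y = refl
  det-scalar (suc k) y = begin
    det (suc k) yI                                            ≈⟨ det-laplace yI ⟩
    laplaceTerm yI zero + sum (laplaceTerm yI ∘ suc)          ≈⟨ +-cong diagonal-term other-terms ⟩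
    y * pow y k + 0#                                          ≈⟨ +-identityʳ _ ⟩
    y * pow y k                                               ∎
    where
    yI : Matrix (suc k)
    yI i j = y * I i j
    diagonal-term : laplaceTerm yI zero ≈ y * pow y k
    diagonal-term = *-cong (trans (*-identityˡ _) (trans (*-congˡ (I-diag {suc k} zero)) (*-identityʳ y)))
                           (trans (det-cong {k} λ a b → *-congˡ {y} (I-suc a b)) (det-scalar k y))
    other-terms : sum (laplaceTerm yI ∘ suc) ≈ 0#
    other-terms = sum-zero (laplaceTerm yI ∘ suc) λ j →
      trans (*-congʳ (trans (*-congˡ (trans (*-congˡ (I-offDiag {i = zero} {suc j} λ ())) (zeroʳ y))) (zeroʳ _))) (zeroˡ _)

  det-identity : ∀ k → det k I ≈ 1#
  det-identity k = trans (det-cong {k} λ i j → ≈-sym (*-identityˡ (I i j))) (trans (det-scalar k 1#) (pow-1# k))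

  ↑-cases : ∀ n {m p} (P : Fin (n ℕ.+ m) → Set p) → (∀ i → P (i ↑ˡ m)) → (∀ l → P (n ↑ʳ l)) → ∀ r → P r
  ↑-cases n P left right r with splitAt n r in eq
  ... | inj₁ i = ≡.subst P (splitAt⁻¹-↑ˡ eq) (left i)
  ... | inj₂ l = ≡.subst P (splitAt⁻¹-↑ʳ eq) (right l)

  ↑ˡ≢↑ʳ : ∀ {n m} (i : Fin n) (l : Fin m) → i ↑ˡ m ≢ n ↑ʳ l
  ↑ˡ≢↑ʳ {n} {m} i l eq with ≡.trans (≡.sym (splitAt-↑ˡ n i m)) (≡.trans (≡.cong (splitAt n) eq) (splitAt-↑ʳ n m l))
  ... | ()

  punchIn-↑ˡ : ∀ {n} m (j : Fin (suc n)) (b : Fin n) → punchIn (j ↑ˡ m) (b ↑ˡ m) ≡ punchIn j b ↑ˡ m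
  punchIn-↑ˡ m zero    b       = ≡.refl
  punchIn-↑ˡ m (suc j) zero    = ≡.refl
  punchIn-↑ˡ m (suc j) (suc b) = ≡.cong suc (punchIn-↑ˡ m j b)

  punchIn-↑ʳ : ∀ {n} m (j : Fin (suc n)) (l : Fin m) → punchIn (j ↑ˡ m) (n ↑ʳ l) ≡ suc n ↑ʳ l
  punchIn-↑ʳ         m zero    l = ≡.refl
  punchIn-↑ʳ {suc n} m (suc j) l = ≡.cong suc (punchIn-↑ʳ m j l)

  det-blockLowerTriangular : ∀ n {m} (M : Matrix (n ℕ.+ m)) (Y : Matrix n) (W : Matrix m) →
                             (∀ i j → M (i ↑ˡ m) (j ↑ˡ m) ≈ Y i j) → (∀ i l → M (i ↑ˡ m) (n ↑ʳ l) ≈ 0#) →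
                             (∀ l l′ → M (n ↑ʳ l) (n ↑ʳ l′) ≈ W l l′) → det (n ℕ.+ m) M ≈ det n Y * det m W
  det-blockLowerTriangular zero    M Y W _ _ M≈W = trans (det-cong M≈W) (≈-sym (*-identityˡ _))
  det-blockLowerTriangular (suc n) {m} M Y W M≈Y M≈0 M≈W = begin
    det _ M                                                        ≈⟨ det-laplace M ⟩
    sum (laplaceTerm M)                                            ≈⟨ sum-↑ (suc n) (laplaceTerm M) ⟩
    sum (λ j → laplaceTerm M (j ↑ˡ m)) + sum (λ l → laplaceTerm M (suc n ↑ʳ l))
      ≈⟨ +-cong (sum-cong _ _ left-term) (sum-zero _ right-term≈0) ⟩
    sum (λ j → laplaceTerm Y j * det m W) + 0#                     ≈⟨ +-identityʳ _ ⟩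
    sum (λ j → laplaceTerm Y j * det m W)
      ≈⟨ *-distribʳ-sum (det m W) (laplaceTerm Y) ⟨
    sum (laplaceTerm Y) * det m W                                  ≈⟨ *-congʳ (det-laplace Y) ⟨
    det (suc n) Y * det m W                                        ∎
    where
    right-term≈0 : ∀ l → laplaceTerm M (suc n ↑ʳ l) ≈ 0#
    right-term≈0 l = trans (*-congʳ (trans (*-congˡ (M≈0 zero l)) (zeroʳ _))) (zeroˡ _)
    left-term : ∀ j → laplaceTerm M (j ↑ˡ m) ≈ laplaceTerm Y j * det m W
    left-term j = trans (*-cong (*-cong (reflexive (≡.cong sign (toℕ-↑ˡ j m))) (M≈Y zero j))
                                (det-blockLowerTriangular n (minor (j ↑ˡ m) M) (minor j Y) W minor≈Y minor≈0 minor≈W))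
                        (≈-sym (*-assoc _ _ _))
      where
      minor≈Y : ∀ i b → minor (j ↑ˡ m) M (i ↑ˡ m) (b ↑ˡ m) ≈ minor j Y i b
      minor≈Y i b = ≡.subst (λ col → M (suc i ↑ˡ m) col ≈ Y (suc i) (punchIn j b)) (≡.sym (punchIn-↑ˡ m j b))
                            (M≈Y (suc i) (punchIn j b))
      minor≈0 : ∀ i l → minor (j ↑ˡ m) M (i ↑ˡ m) (n ↑ʳ l) ≈ 0#
      minor≈0 i l = ≡.subst (λ col → M (suc i ↑ˡ m) col ≈ 0#) (≡.sym (punchIn-↑ʳ m j l)) (M≈0 (suc i) l)
      minor≈W : ∀ l l′ → minor (j ↑ˡ m) M (n ↑ʳ l) (n ↑ʳ l′) ≈ W l l′
      minor≈W l l′ = ≡.subst (λ col → M (suc n ↑ʳ l) col ≈ W l l′) (≡.sym (punchIn-↑ʳ m j l′)) (M≈W l l′)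

  det-blockUpperTriangular-identity : ∀ n {m} (M : Matrix (n ℕ.+ m)) (Y : Matrix n) →
                                      (∀ i j → M (i ↑ˡ m) (j ↑ˡ m) ≈ Y i j) → (∀ l j → M (n ↑ʳ l) (j ↑ˡ m) ≈ 0#) →
                                      (∀ l l′ → M (n ↑ʳ l) (n ↑ʳ l′) ≈ I l l′) → det (n ℕ.+ m) M ≈ det n Y
  det-blockUpperTriangular-identity zero    {m} M Y _ _ M≈I = trans (det-cong M≈I) (det-identity m)
  det-blockUpperTriangular-identity (suc n) {m} M Y M≈Y M≈0 M≈I = begin
    det _ M                                                        ≈⟨ det-laplace M ⟩
    sum (laplaceTerm M)                                            ≈⟨ sum-↑ (suc n) (laplaceTerm M) ⟩
    sum (λ j → laplaceTerm M (j ↑ˡ m)) + sum (λ l → laplaceTerm M (suc n ↑ʳ l))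
      ≈⟨ +-cong (sum-cong _ _ left-term) (sum-zero _ right-term≈0) ⟩
    sum (laplaceTerm Y) + 0#                                       ≈⟨ +-identityʳ _ ⟩
    sum (laplaceTerm Y)                                            ≈⟨ det-laplace Y ⟨
    det (suc n) Y                                                  ∎
    where
    -- deleting column n+l leaves row n+l of the identity block without its only nonzero entry
    right-term≈0 : ∀ l → laplaceTerm M (suc n ↑ʳ l) ≈ 0#
    right-term≈0 l = trans (*-congˡ (det-zero-row (minor (suc n ↑ʳ l) M) (n ↑ʳ l) row≈0)) (zeroʳ _)
      where
      row≈0 : ∀ b → M (suc n ↑ʳ l) (punchIn (suc n ↑ʳ l) b) ≈ 0#
      row≈0 b = ↑-cases (suc n) (λ col → punchIn (suc n ↑ʳ l) b ≡ col → M (suc n ↑ʳ l) col ≈ 0#)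
        (λ j _ → M≈0 l j)
        (λ l′ eq → trans (M≈I l l′) (I-offDiag λ l≡l′ →
                     punchInᵢ≢i _ b (≡.trans eq (≡.cong (suc n ↑ʳ_) (≡.sym l≡l′)))))
        (punchIn (suc n ↑ʳ l) b) ≡.refl
    left-term : ∀ j → laplaceTerm M (j ↑ˡ m) ≈ laplaceTerm Y j
    left-term j = *-cong (*-cong (reflexive (≡.cong sign (toℕ-↑ˡ j m))) (M≈Y zero j))
                         (det-blockUpperTriangular-identity n (minor (j ↑ˡ m) M) (minor j Y) minor≈Y minor≈0 minor≈I)
      where
      minor≈Y : ∀ i b → minor (j ↑ˡ m) M (i ↑ˡ m) (b ↑ˡ m) ≈ minor j Y i b
      minor≈Y i b = ≡.subst (λ col → M (suc i ↑ˡ m) col ≈ Y (suc i) (punchIn j b)) (≡.sym (punchIn-↑ˡ m j b))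
                            (M≈Y (suc i) (punchIn j b))
      minor≈0 : ∀ l b → minor (j ↑ˡ m) M (n ↑ʳ l) (b ↑ˡ m) ≈ 0#
      minor≈0 l b = ≡.subst (λ col → M (suc n ↑ʳ l) col ≈ 0#) (≡.sym (punchIn-↑ˡ m j b)) (M≈0 l (punchIn j b))
      minor≈I : ∀ l l′ → minor (j ↑ˡ m) M (n ↑ʳ l) (n ↑ʳ l′) ≈ I l l′
      minor≈I l l′ = ≡.subst (λ col → M (suc n ↑ʳ l) col ≈ I l l′) (≡.sym (punchIn-↑ʳ m j l′)) (M≈I l l′)

  infixl 7 _*ᴹ_
  _*ᴹ_ : ∀ {n m p} → (Fin n → Fin m → Carrier) → (Fin m → Fin p → Carrier) → Fin n → Fin p → Carrier
  (X *ᴹ Y) i j = sum (λ l → X i l * Y l j)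

  block : ∀ {n m} → Matrix n → (Fin n → Fin m → Carrier) → (Fin m → Fin n → Carrier) → Matrix m → Matrix (n ℕ.+ m)
  block {n} A B C D r s =
    [ (λ i → [ A i , B i ]′ (splitAt n s)) , (λ l → [ C l , D l ]′ (splitAt n s)) ]′ (splitAt n r)

  module _ {n m} (A : Matrix n) (B : Fin n → Fin m → Carrier) (C : Fin m → Fin n → Carrier) (D : Matrix m) where

    block-↑ˡ↑ˡ : ∀ i j → block A B C D (i ↑ˡ m) (j ↑ˡ m) ≡ A i j
    block-↑ˡ↑ˡ i j rewrite splitAt-↑ˡ n i m | splitAt-↑ˡ n j m = ≡.refl

    block-↑ˡ↑ʳ : ∀ i l → block A B C D (i ↑ˡ m) (n ↑ʳ l) ≡ B i l
    block-↑ˡ↑ʳ i l rewrite splitAt-↑ˡ n i m | splitAt-↑ʳ n m l = ≡.refl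

    block-↑ʳ↑ˡ : ∀ l j → block A B C D (n ↑ʳ l) (j ↑ˡ m) ≡ C l j
    block-↑ʳ↑ˡ l j rewrite splitAt-↑ʳ n m l | splitAt-↑ˡ n j m = ≡.refl

    block-↑ʳ↑ʳ : ∀ l l′ → block A B C D (n ↑ʳ l) (n ↑ʳ l′) ≡ D l l′
    block-↑ʳ↑ʳ l l′ rewrite splitAt-↑ʳ n m l | splitAt-↑ʳ n m l′ = ≡.refl

    block-col-↑ˡ : ∀ r j → block A B C D r (j ↑ˡ m) ≡ [ (λ i → A i j) , (λ l → C l j) ]′ (splitAt n r)
    block-col-↑ˡ r j rewrite splitAt-↑ˡ n j m = ≡.refl

    block-col-↑ʳ : ∀ r l → block A B C D r (n ↑ʳ l) ≡ [ (λ i → B i l) , (λ l′ → D l′ l) ]′ (splitAt n r)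
    block-col-↑ʳ r l rewrite splitAt-↑ʳ n m l = ≡.refl

  det-block-addToLeftCols : ∀ {n m} a (w : Fin n → Fin m → Carrier) (A A′ : Matrix n) (B : Fin n → Fin m → Carrier)
                            (C C′ : Fin m → Fin n → Carrier) (D : Matrix m) →
                            (∀ i j → A′ i j ≈ a * A i j + sum (λ l → w j l * B i l)) →
                            (∀ l′ j → C′ l′ j ≈ a * C l′ j + sum (λ l → w j l * D l′ l)) →
                            det (n ℕ.+ m) (block A′ B C′ D) ≈ pow a n * det (n ℕ.+ m) (block A B C D)
  det-block-addToLeftCols {n} {m} a w A A′ B C C′ D A′≈ C′≈ =
    det-add-col-combinations a (_↑ˡ m) (n ↑ʳ_) w (↑ˡ-injective m _ _) (λ j l → ↑ˡ≢↑ʳ j l ∘ ≡.sym)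
                             untouched combination
    where
    K K′ : Matrix (n ℕ.+ m)
    K  = block A B C D
    K′ = block A′ B C′ D
    untouched : ∀ r c → (∀ j → c ≢ j ↑ˡ m) → K′ r c ≈ K r c
    untouched r = ↑-cases n (λ c → (∀ j → c ≢ j ↑ˡ m) → K′ r c ≈ K r c)
      (λ j c≢ → contradiction ≡.refl (c≢ j)) λ l _ → reflexive (≡.trans (block-col-↑ʳ A′ B C′ D r l) (≡.sym (block-col-↑ʳ A B C D r l)))
    combination : ∀ r j → K′ r (j ↑ˡ m) ≈ a * K r (j ↑ˡ m) + sum (λ l → w j l * K r (n ↑ʳ l))
    combination r j = ↑-cases n (λ r → K′ r (j ↑ˡ m) ≈ a * K r (j ↑ˡ m) + sum (λ l → w j l * K r (n ↑ʳ l)))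
      (λ i → trans (reflexive (block-↑ˡ↑ˡ A′ B C′ D i j)) (trans (A′≈ i j)
        (+-cong (*-congˡ (reflexive (≡.sym (block-↑ˡ↑ˡ A B C D i j))))
                (sum-cong _ (λ l → w j l * K (i ↑ˡ m) (n ↑ʳ l)) λ l →
                   *-congˡ (reflexive (≡.sym (block-↑ˡ↑ʳ A B C D i l)))))))
      (λ l′ → trans (reflexive (block-↑ʳ↑ˡ A′ B C′ D l′ j)) (trans (C′≈ l′ j)
        (+-cong (*-congˡ (reflexive (≡.sym (block-↑ʳ↑ˡ A B C D l′ j))))
                (sum-cong _ (λ l → w j l * K (n ↑ʳ l′) (n ↑ʳ l)) λ l →
                   *-congˡ (reflexive (≡.sym (block-↑ʳ↑ʳ A B C D l′ l)))))))
      r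

  det-block-addToRightCols : ∀ {n m} a (w : Fin m → Fin n → Carrier) (A : Matrix n) (B B′ : Fin n → Fin m → Carrier)
                             (C : Fin m → Fin n → Carrier) (D D′ : Matrix m) →
                             (∀ i l → B′ i l ≈ a * B i l + sum (λ j → w l j * A i j)) →
                             (∀ l′ l → D′ l′ l ≈ a * D l′ l + sum (λ j → w l j * C l′ j)) →
                             det (n ℕ.+ m) (block A B′ C D′) ≈ pow a m * det (n ℕ.+ m) (block A B C D)
  det-block-addToRightCols {n} {m} a w A B B′ C D D′ B′≈ D′≈ =
    det-add-col-combinations a (n ↑ʳ_) (_↑ˡ m) w (↑ʳ-injective n _ _) (λ l j → ↑ˡ≢↑ʳ j l) untouched combination
    where
    K K′ : Matrix (n ℕ.+ m)
    K  = block A B C D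
    K′ = block A B′ C D′
    untouched : ∀ r c → (∀ l → c ≢ n ↑ʳ l) → K′ r c ≈ K r c
    untouched r = ↑-cases n (λ c → (∀ l → c ≢ n ↑ʳ l) → K′ r c ≈ K r c)
      (λ j _ → reflexive (≡.trans (block-col-↑ˡ A B′ C D′ r j) (≡.sym (block-col-↑ˡ A B C D r j))))
      (λ l c≢ → contradiction ≡.refl (c≢ l))
    combination : ∀ r l → K′ r (n ↑ʳ l) ≈ a * K r (n ↑ʳ l) + sum (λ j → w l j * K r (j ↑ˡ m))
    combination r l = ↑-cases n (λ r → K′ r (n ↑ʳ l) ≈ a * K r (n ↑ʳ l) + sum (λ j → w l j * K r (j ↑ˡ m)))
      (λ i → trans (reflexive (block-↑ˡ↑ʳ A B′ C D′ i l)) (trans (B′≈ i l)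
        (+-cong (*-congˡ (reflexive (≡.sym (block-↑ˡ↑ʳ A B C D i l))))
                (sum-cong _ (λ j → w l j * K (i ↑ˡ m) (j ↑ˡ m)) λ j →
                   *-congˡ (reflexive (≡.sym (block-↑ˡ↑ˡ A B C D i j)))))))
      (λ l′ → trans (reflexive (block-↑ʳ↑ʳ A B′ C D′ l′ l)) (trans (D′≈ l′ l)
        (+-cong (*-congˡ (reflexive (≡.sym (block-↑ʳ↑ʳ A B C D l′ l))))
                (sum-cong _ (λ j → w l j * K (n ↑ʳ l′) (j ↑ˡ m)) λ j →
                   *-congˡ (reflexive (≡.sym (block-↑ʳ↑ˡ A B C D l′ j)))))))
      r

  -- Subtracting Σ_l C l j · (column n+l) from each column j < n clears the lower left block.
  det-schur-identityBlock : ∀ {n m} (A : Matrix n) (B : Fin n → Fin m → Carrier) (C : Fin m → Fin n → Carrier) →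
                            det (n ℕ.+ m) (block A B C I) ≈ det n (λ i j → A i j + - (B *ᴹ C) i j)
  det-schur-identityBlock {n} {m} A B C = begin
    det _ (block A B C I)             ≈⟨ trans (*-congʳ (pow-1# n)) (*-identityˡ _) ⟨
    pow 1# n * det _ (block A B C I)  ≈⟨ det-block-addToLeftCols 1# (λ j l → - C l j) A S B C 0ᴹ I S≈ 0≈ ⟨
    det _ (block S B 0ᴹ I)            ≈⟨ det-blockUpperTriangular-identity n (block S B 0ᴹ I) S
                                           (λ i j → reflexive (block-↑ˡ↑ˡ S B 0ᴹ I i j))
                                           (λ l j → reflexive (block-↑ʳ↑ˡ S B 0ᴹ I l j))
                                           (λ l l′ → reflexive (block-↑ʳ↑ʳ S B 0ᴹ I l l′)) ⟩
    det n S                           ∎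
    where
    S : Matrix n
    S i j = A i j + - (B *ᴹ C) i j
    0ᴹ : Fin m → Fin n → Carrier
    0ᴹ _ _ = 0#
    S≈ : ∀ i j → S i j ≈ 1# * A i j + sum (λ l → - C l j * B i l)
    S≈ i j = +-cong (≈-sym (*-identityˡ _)) (trans (-‿sum (λ l → B i l * C l j))
               (sum-cong _ (λ l → - C l j * B i l) λ l → trans (-‿cong (*-comm _ _)) (-‿distribˡ-* _ _)))
    0≈ : ∀ l′ j → 0# ≈ 1# * C l′ j + sum (λ l → - C l j * I l′ l)
    0≈ l′ j = ≈-sym (trans (+-cong (*-identityˡ _) (sum-*I l′ (λ l → - C l j))) (-‿inverseʳ (C l′ j)))

  -- Replacing column n+l by y · (column n+l) - Σ_j B j l · (column j) clears the upper right block.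
  det-schur-scalarBlock : ∀ {n m} (y : Carrier) (B : Fin n → Fin m → Carrier) (C : Fin m → Fin n → Carrier)
                          (D : Matrix m) →
                          pow y m * det (n ℕ.+ m) (block (λ i j → y * I i j) B C D)
                            ≈ pow y n * det m (λ l l′ → y * D l l′ + - (C *ᴹ B) l l′)
  det-schur-scalarBlock {n} {m} y B C D = begin
    pow y m * det _ (block yI B C D)  ≈⟨ det-block-addToRightCols y (λ l j → - B j l) yI B 0ᴹ C D T 0≈ T≈ ⟨
    det _ (block yI 0ᴹ C T)           ≈⟨ det-blockLowerTriangular n (block yI 0ᴹ C T) yI T
                                           (λ i j → reflexive (block-↑ˡ↑ˡ yI 0ᴹ C T i j))
                                           (λ i l → reflexive (block-↑ˡ↑ʳ yI 0ᴹ C T i l))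
                                           (λ l l′ → reflexive (block-↑ʳ↑ʳ yI 0ᴹ C T l l′)) ⟩
    det n yI * det m T                ≈⟨ *-congʳ (det-scalar n y) ⟩
    pow y n * det m T                 ∎
    where
    yI : Matrix n
    yI i j = y * I i j
    T : Matrix m
    T l l′ = y * D l l′ + - (C *ᴹ B) l l′
    0ᴹ : Fin n → Fin m → Carrier
    0ᴹ _ _ = 0#
    0≈ : ∀ i l → 0# ≈ y * B i l + sum (λ j → - B j l * (y * I i j))
    0≈ i l = begin
      0#                                            ≈⟨ solve 2 (λ y b → y :* b :+ :- b :* y := con (ℤ.+ 0)) refl y (B i l) ⟨
      y * B i l + - B i l * y                       ≈⟨ +-congˡ (sum-*I i (λ j → - B j l * y)) ⟨
      y * B i l + sum (λ j → - B j l * y * I i j)   ≈⟨ +-congˡ (sum-cong _ (λ j → - B j l * (y * I i j)) λ j → *-assoc _ _ _) ⟩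
      y * B i l + sum (λ j → - B j l * (y * I i j)) ∎
    T≈ : ∀ l′ l → T l′ l ≈ y * D l′ l + sum (λ j → - B j l * C l′ j)
    T≈ l′ l = +-congˡ (trans (-‿sum (λ j → C l′ j * B j l))
                (sum-cong _ (λ j → - B j l * C l′ j) λ j → trans (-‿cong (*-comm _ _)) (-‿distribˡ-* _ _)))

  charPoly-*ᴹ-sylvester : ∀ {n m} (X : Fin n → Fin m → Carrier) (Y : Fin m → Fin n → Carrier) y →
                          pow y m * charPoly (X *ᴹ Y) y ≈ pow y n * charPoly (Y *ᴹ X) y
  charPoly-*ᴹ-sylvester {n} {m} X Y y = begin
    pow y m * charPoly (X *ᴹ Y) y
      ≈⟨ *-congˡ (det-schur-identityBlock (λ i j → y * I i j) X Y) ⟨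
    pow y m * det (n ℕ.+ m) (block (λ i j → y * I i j) X Y I)  ≈⟨ det-schur-scalarBlock y X Y I ⟩
    pow y n * charPoly (Y *ᴹ X) y                      ∎

module Polynomial {c ℓ} (R : CommutativeRing c ℓ) where
  open CommutativeRing R hiding (zero) renaming (sym to ≈-sym)
  open IntegerCoefficientSolver R using (solve; _:=_; _:+_; _:*_)
  open RingProperties ring using (-0#≈0#; -‿distribʳ-*; -‿+-comm)
  open import Algebra.Properties.CommutativeSemigroup +-commutativeSemigroup using (x∙yz≈y∙xz)
  open import Relation.Binary.Reasoning.Setoid setoid

  -- Coefficient lists, lowest degree first; _≈ₚ_ identifies lists that differ by trailing zeros.
  Poly : Set c
  Poly = List Carrier

  coeff : Poly → ℕ → Carrier
  coeff []      _       = 0#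
  coeff (a ∷ p) zero    = a
  coeff (a ∷ p) (suc k) = coeff p k

  infix 4 _≈ₚ_
  record _≈ₚ_ (p q : Poly) : Set ℓ where
    field coeff-≈ : ∀ k → coeff p k ≈ coeff q k
  open _≈ₚ_

  infixl 6 _+ₚ_
  _+ₚ_ : Poly → Poly → Poly
  []      +ₚ q       = q
  (a ∷ p) +ₚ []      = a ∷ p
  (a ∷ p) +ₚ (b ∷ q) = (a + b) ∷ (p +ₚ q)

  -ₚ_ : Poly → Poly
  -ₚ p = List.map (λ a → - a) p

  infixr 7 _·ₚ_
  _·ₚ_ : Carrier → Poly → Poly
  a ·ₚ p = List.map (a *_) p

  infixl 7 _*ₚ_
  _*ₚ_ : Poly → Poly → Poly
  []      *ₚ q = []
  (a ∷ p) *ₚ q = a ·ₚ q +ₚ (0# ∷ p *ₚ q)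

  1ₚ X : Poly
  1ₚ = 1# ∷ []
  X  = 0# ∷ 1ₚ

  coeff-+ : ∀ p q k → coeff (p +ₚ q) k ≈ coeff p k + coeff q k
  coeff-+ []      q       k       = ≈-sym (+-identityˡ _)
  coeff-+ (a ∷ p) []      k       = ≈-sym (+-identityʳ _)
  coeff-+ (a ∷ p) (b ∷ q) zero    = refl
  coeff-+ (a ∷ p) (b ∷ q) (suc k) = coeff-+ p q k

  coeff-neg : ∀ p k → coeff (-ₚ p) k ≈ - coeff p k
  coeff-neg []      k       = ≈-sym -0#≈0#
  coeff-neg (a ∷ p) zero    = refl
  coeff-neg (a ∷ p) (suc k) = coeff-neg p k

  coeff-· : ∀ a p k → coeff (a ·ₚ p) k ≈ a * coeff p k
  coeff-· a []      k       = ≈-sym (zeroʳ a)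
  coeff-· a (b ∷ p) zero    = refl
  coeff-· a (b ∷ p) (suc k) = coeff-· a p k

  coeff-∷* : ∀ a p q k → coeff ((a ∷ p) *ₚ q) k ≈ a * coeff q k + coeff (0# ∷ p *ₚ q) k
  coeff-∷* a p q k = trans (coeff-+ (a ·ₚ q) (0# ∷ p *ₚ q) k) (+-congʳ (coeff-· a q k))

  ∷-cong : ∀ {a b p q} → a ≈ b → p ≈ₚ q → a ∷ p ≈ₚ b ∷ q
  ∷-cong a≈b p≈q .coeff-≈ zero    = a≈b
  ∷-cong a≈b p≈q .coeff-≈ (suc k) = coeff-≈ p≈q k

  ≈ₚ-refl : ∀ {p} → p ≈ₚ p
  ≈ₚ-refl .coeff-≈ _ = refl

  ≈ₚ-sym : ∀ {p q} → p ≈ₚ q → q ≈ₚ p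
  ≈ₚ-sym p≈q .coeff-≈ k = ≈-sym (coeff-≈ p≈q k)

  ≈ₚ-trans : ∀ {p q r} → p ≈ₚ q → q ≈ₚ r → p ≈ₚ r
  ≈ₚ-trans p≈q q≈r .coeff-≈ k = trans (coeff-≈ p≈q k) (coeff-≈ q≈r k)

  +ₚ-cong : ∀ {p p′ q q′} → p ≈ₚ p′ → q ≈ₚ q′ → p +ₚ q ≈ₚ p′ +ₚ q′
  +ₚ-cong {p} {p′} {q} {q′} p≈p′ q≈q′ .coeff-≈ k =
    trans (coeff-+ p q k) (trans (+-cong (coeff-≈ p≈p′ k) (coeff-≈ q≈q′ k)) (≈-sym (coeff-+ p′ q′ k)))

  -ₚ-cong : ∀ {p q} → p ≈ₚ q → -ₚ p ≈ₚ -ₚ q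
  -ₚ-cong {p} {q} p≈q .coeff-≈ k = trans (coeff-neg p k) (trans (-‿cong (coeff-≈ p≈q k)) (≈-sym (coeff-neg q k)))

  ·ₚ-cong : ∀ {a b p q} → a ≈ b → p ≈ₚ q → a ·ₚ p ≈ₚ b ·ₚ q
  ·ₚ-cong {a} {b} {p} {q} a≈b p≈q .coeff-≈ k =
    trans (coeff-· a p k) (trans (*-cong a≈b (coeff-≈ p≈q k)) (≈-sym (coeff-· b q k)))

  ∷-tail : ∀ {a b p q} → a ∷ p ≈ₚ b ∷ q → p ≈ₚ q
  ∷-tail a∷p≈b∷q .coeff-≈ k = coeff-≈ a∷p≈b∷q (suc k)

  ∷-tail-≈[] : ∀ {a p} → a ∷ p ≈ₚ [] → p ≈ₚ []
  ∷-tail-≈[] a∷p≈0 .coeff-≈ k = coeff-≈ a∷p≈0 (suc k)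

  *ₚ-zeroˡ : ∀ p q → p ≈ₚ [] → p *ₚ q ≈ₚ []
  *ₚ-zeroˡ []      q _   = ≈ₚ-refl
  *ₚ-zeroˡ (a ∷ p) q p≈0 .coeff-≈ k = begin
    coeff ((a ∷ p) *ₚ q) k                  ≈⟨ coeff-∷* a p q k ⟩
    a * coeff q k + coeff (0# ∷ p *ₚ q) k
      ≈⟨ +-cong (trans (*-congʳ (coeff-≈ p≈0 zero)) (zeroˡ _)) (shifted≈0 k) ⟩
    0# + 0#                                 ≈⟨ +-identityˡ 0# ⟩
    0#                                      ∎
    where
    shifted≈0 : ∀ k → coeff (0# ∷ p *ₚ q) k ≈ 0#
    shifted≈0 zero    = refl
    shifted≈0 (suc k) = coeff-≈ (*ₚ-zeroˡ p q (∷-tail-≈[] p≈0)) k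

  *ₚ-zeroʳ : ∀ p → p *ₚ [] ≈ₚ []
  *ₚ-zeroʳ []      = ≈ₚ-refl
  *ₚ-zeroʳ (a ∷ p) .coeff-≈ zero    = refl
  *ₚ-zeroʳ (a ∷ p) .coeff-≈ (suc k) = coeff-≈ (*ₚ-zeroʳ p) k


  *ₚ-congˡ : ∀ {p p′} q → p ≈ₚ p′ → p *ₚ q ≈ₚ p′ *ₚ q
  *ₚ-congˡ {[]}    {[]}     q _    = ≈ₚ-refl
  *ₚ-congˡ {[]}    {b ∷ p′} q p≈p′ = ≈ₚ-sym (*ₚ-zeroˡ (b ∷ p′) q (≈ₚ-sym p≈p′))
  *ₚ-congˡ {a ∷ p} {[]}     q p≈p′ = *ₚ-zeroˡ (a ∷ p) q p≈p′
  *ₚ-congˡ {a ∷ p} {b ∷ p′} q p≈p′ =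
    +ₚ-cong (·ₚ-cong (coeff-≈ p≈p′ zero) ≈ₚ-refl) (∷-cong refl (*ₚ-congˡ q (∷-tail p≈p′)))

  *ₚ-congʳ : ∀ p {q q′} → q ≈ₚ q′ → p *ₚ q ≈ₚ p *ₚ q′
  *ₚ-congʳ []      q≈q′ = ≈ₚ-refl
  *ₚ-congʳ (a ∷ p) q≈q′ = +ₚ-cong (·ₚ-cong refl q≈q′) (∷-cong refl (*ₚ-congʳ p q≈q′))

  *ₚ-∷ʳ : ∀ p b q → p *ₚ (b ∷ q) ≈ₚ b ·ₚ p +ₚ (0# ∷ p *ₚ q)
  *ₚ-∷ʳ []      b q .coeff-≈ zero    = refl
  *ₚ-∷ʳ []      b q .coeff-≈ (suc k) = refl
  *ₚ-∷ʳ (a ∷ p) b q .coeff-≈ zero    = +-congʳ (*-comm a b)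
  *ₚ-∷ʳ (a ∷ p) b q .coeff-≈ (suc k) = begin
    coeff (a ·ₚ q +ₚ p *ₚ (b ∷ q)) k                                ≈⟨ coeff-+ (a ·ₚ q) _ k ⟩
    coeff (a ·ₚ q) k + coeff (p *ₚ (b ∷ q)) k
      ≈⟨ +-congˡ (trans (coeff-≈ (*ₚ-∷ʳ p b q) k) (coeff-+ (b ·ₚ p) _ k)) ⟩
    coeff (a ·ₚ q) k + (coeff (b ·ₚ p) k + coeff (0# ∷ p *ₚ q) k)   ≈⟨ x∙yz≈y∙xz _ _ _ ⟩
    coeff (b ·ₚ p) k + (coeff (a ·ₚ q) k + coeff (0# ∷ p *ₚ q) k)   ≈⟨ +-congˡ (coeff-+ (a ·ₚ q) _ k) ⟨
    coeff (b ·ₚ p) k + coeff (a ·ₚ q +ₚ (0# ∷ p *ₚ q)) k            ≈⟨ coeff-+ (b ·ₚ p) _ k ⟨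
    coeff (b ·ₚ p +ₚ (a ·ₚ q +ₚ (0# ∷ p *ₚ q))) k                   ∎

  *ₚ-comm : ∀ p q → p *ₚ q ≈ₚ q *ₚ p
  *ₚ-comm []      q       = ≈ₚ-sym (*ₚ-zeroʳ q)
  *ₚ-comm (a ∷ p) []      = *ₚ-zeroʳ (a ∷ p)
  *ₚ-comm (a ∷ p) (b ∷ q) .coeff-≈ zero    = +-congʳ (*-comm a b)
  *ₚ-comm (a ∷ p) (b ∷ q) .coeff-≈ (suc k) = begin
    coeff (a ·ₚ q +ₚ p *ₚ (b ∷ q)) k                                ≈⟨ coeff-+ (a ·ₚ q) _ k ⟩
    coeff (a ·ₚ q) k + coeff (p *ₚ (b ∷ q)) k
      ≈⟨ +-congˡ (trans (coeff-≈ (*ₚ-∷ʳ p b q) k) (coeff-+ (b ·ₚ p) _ k)) ⟩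
    coeff (a ·ₚ q) k + (coeff (b ·ₚ p) k + coeff (0# ∷ p *ₚ q) k)
      ≈⟨ +-congˡ (+-congˡ (coeff-≈ (∷-cong refl (*ₚ-comm p q)) k)) ⟩
    coeff (a ·ₚ q) k + (coeff (b ·ₚ p) k + coeff (0# ∷ q *ₚ p) k)   ≈⟨ x∙yz≈y∙xz _ _ _ ⟩
    coeff (b ·ₚ p) k + (coeff (a ·ₚ q) k + coeff (0# ∷ q *ₚ p) k)
      ≈⟨ +-congˡ (trans (coeff-≈ (*ₚ-∷ʳ q a p) k) (coeff-+ (a ·ₚ q) _ k)) ⟨
    coeff (b ·ₚ p) k + coeff (q *ₚ (a ∷ p)) k                       ≈⟨ coeff-+ (b ·ₚ p) _ k ⟨
    coeff (b ·ₚ p +ₚ q *ₚ (a ∷ p)) k                                ∎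

  *ₚ-distribˡ : ∀ p q r → p *ₚ (q +ₚ r) ≈ₚ p *ₚ q +ₚ p *ₚ r
  *ₚ-distribˡ []      q r = ≈ₚ-refl
  *ₚ-distribˡ (a ∷ p) q r .coeff-≈ k = begin
    coeff ((a ∷ p) *ₚ (q +ₚ r)) k                                   ≈⟨ coeff-∷* a p (q +ₚ r) k ⟩
    a * coeff (q +ₚ r) k + coeff (0# ∷ p *ₚ (q +ₚ r)) k
      ≈⟨ +-cong (*-congˡ (coeff-+ q r k)) (trans (coeff-≈ shifted k) (coeff-+ (0# ∷ p *ₚ q) (0# ∷ p *ₚ r) k)) ⟩
    a * (coeff q k + coeff r k) + (coeff (0# ∷ p *ₚ q) k + coeff (0# ∷ p *ₚ r) k)
      ≈⟨ solve 5 (λ a x y u v → a :* (x :+ y) :+ (u :+ v) := (a :* x :+ u) :+ (a :* y :+ v)) refl a _ _ _ _ ⟩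
    (a * coeff q k + coeff (0# ∷ p *ₚ q) k) + (a * coeff r k + coeff (0# ∷ p *ₚ r) k)
      ≈⟨ +-cong (coeff-∷* a p q k) (coeff-∷* a p r k) ⟨
    coeff ((a ∷ p) *ₚ q) k + coeff ((a ∷ p) *ₚ r) k                 ≈⟨ coeff-+ ((a ∷ p) *ₚ q) _ k ⟨
    coeff ((a ∷ p) *ₚ q +ₚ (a ∷ p) *ₚ r) k                          ∎
    where
    shifted : 0# ∷ p *ₚ (q +ₚ r) ≈ₚ (0# ∷ p *ₚ q) +ₚ (0# ∷ p *ₚ r)
    shifted = ∷-cong (≈-sym (+-identityˡ 0#)) (*ₚ-distribˡ p q r)

  *ₚ-distribʳ : ∀ r p q → (p +ₚ q) *ₚ r ≈ₚ p *ₚ r +ₚ q *ₚ r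
  *ₚ-distribʳ r p q = ≈ₚ-trans (*ₚ-comm (p +ₚ q) r)
    (≈ₚ-trans (*ₚ-distribˡ r p q) (+ₚ-cong (*ₚ-comm r p) (*ₚ-comm r q)))

  ·ₚ-*ₚ : ∀ a q r → (a ·ₚ q) *ₚ r ≈ₚ a ·ₚ (q *ₚ r)
  ·ₚ-*ₚ a []      r = ≈ₚ-refl
  ·ₚ-*ₚ a (b ∷ q) r .coeff-≈ k = begin
    coeff ((a * b) ·ₚ r +ₚ (0# ∷ (a ·ₚ q) *ₚ r)) k          ≈⟨ coeff-+ ((a * b) ·ₚ r) _ k ⟩
    coeff ((a * b) ·ₚ r) k + coeff (0# ∷ (a ·ₚ q) *ₚ r) k   ≈⟨ +-cong (coeff-· (a * b) r k) (shifted k) ⟩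
    a * b * coeff r k + a * coeff (0# ∷ q *ₚ r) k
      ≈⟨ trans (distribˡ _ _ _) (+-congʳ (≈-sym (*-assoc _ _ _))) ⟨
    a * (b * coeff r k + coeff (0# ∷ q *ₚ r) k)             ≈⟨ *-congˡ (coeff-∷* b q r k) ⟨
    a * coeff ((b ∷ q) *ₚ r) k                              ≈⟨ coeff-· a ((b ∷ q) *ₚ r) k ⟨
    coeff (a ·ₚ ((b ∷ q) *ₚ r)) k                           ∎
    where
    shifted : ∀ k → coeff (0# ∷ (a ·ₚ q) *ₚ r) k ≈ a * coeff (0# ∷ q *ₚ r) k
    shifted zero    = ≈-sym (zeroʳ a)
    shifted (suc k) = trans (coeff-≈ (·ₚ-*ₚ a q r) k) (coeff-· a (q *ₚ r) k)

  shift-*ₚ : ∀ p q → (0# ∷ p) *ₚ q ≈ₚ 0# ∷ p *ₚ q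
  shift-*ₚ p q .coeff-≈ k = trans (coeff-∷* 0# p q k) (trans (+-congʳ (zeroˡ _)) (+-identityˡ _))

  *ₚ-assoc : ∀ p q r → (p *ₚ q) *ₚ r ≈ₚ p *ₚ (q *ₚ r)
  *ₚ-assoc []      q r = ≈ₚ-refl
  *ₚ-assoc (a ∷ p) q r = ≈ₚ-trans (*ₚ-distribʳ r (a ·ₚ q) (0# ∷ p *ₚ q))
    (+ₚ-cong (·ₚ-*ₚ a q r) (≈ₚ-trans (shift-*ₚ (p *ₚ q) r) (∷-cong refl (*ₚ-assoc p q r))))

  *ₚ-identityˡ : ∀ p → 1ₚ *ₚ p ≈ₚ p
  *ₚ-identityˡ p .coeff-≈ k = begin
    coeff (1ₚ *ₚ p) k                    ≈⟨ coeff-∷* 1# [] p k ⟩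
    1# * coeff p k + coeff (0# ∷ []) k   ≈⟨ +-cong (*-identityˡ _) (zero-coeff k) ⟩
    coeff p k + 0#                       ≈⟨ +-identityʳ _ ⟩
    coeff p k                            ∎
    where
    zero-coeff : ∀ k → coeff (0# ∷ []) k ≈ 0#
    zero-coeff zero    = refl
    zero-coeff (suc k) = refl

  +ₚ-assoc : ∀ p q r → (p +ₚ q) +ₚ r ≈ₚ p +ₚ (q +ₚ r)
  +ₚ-assoc p q r .coeff-≈ k = begin
    coeff ((p +ₚ q) +ₚ r) k                    ≈⟨ trans (coeff-+ (p +ₚ q) r k) (+-congʳ (coeff-+ p q k)) ⟩
    (coeff p k + coeff q k) + coeff r k        ≈⟨ +-assoc _ _ _ ⟩
    coeff p k + (coeff q k + coeff r k)        ≈⟨ trans (coeff-+ p (q +ₚ r) k) (+-congˡ (coeff-+ q r k)) ⟨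
    coeff (p +ₚ (q +ₚ r)) k                    ∎

  +ₚ-comm : ∀ p q → p +ₚ q ≈ₚ q +ₚ p
  +ₚ-comm p q .coeff-≈ k = trans (coeff-+ p q k) (trans (+-comm _ _) (≈-sym (coeff-+ q p k)))

  +ₚ-identityʳ : ∀ p → p +ₚ [] ≈ₚ p
  +ₚ-identityʳ p .coeff-≈ k = trans (coeff-+ p [] k) (+-identityʳ _)

  -ₚ‿inverseˡ : ∀ p → -ₚ p +ₚ p ≈ₚ []
  -ₚ‿inverseˡ p .coeff-≈ k = trans (coeff-+ (-ₚ p) p k) (trans (+-congʳ (coeff-neg p k)) (-‿inverseˡ _))

  -ₚ‿inverseʳ : ∀ p → p +ₚ -ₚ p ≈ₚ []
  -ₚ‿inverseʳ p = ≈ₚ-trans (+ₚ-comm p (-ₚ p)) (-ₚ‿inverseˡ p)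

  +ₚ-*ₚ-isCommutativeRing : IsCommutativeRing _≈ₚ_ _+ₚ_ _*ₚ_ -ₚ_ [] 1ₚ
  +ₚ-*ₚ-isCommutativeRing = record
    { isRing = record
      { +-isAbelianGroup = record
        { isGroup = record
          { isMonoid = record
            { isSemigroup = record
              { isMagma = record
                { isEquivalence = record { refl = ≈ₚ-refl ; sym = ≈ₚ-sym ; trans = ≈ₚ-trans }
                ; ∙-cong        = +ₚ-cong
                }
              ; assoc = +ₚ-assoc
              }
            ; identity = (λ _ → ≈ₚ-refl) , +ₚ-identityʳ
            }
          ; inverse = -ₚ‿inverseˡ , -ₚ‿inverseʳ
          ; ⁻¹-cong = -ₚ-cong
          }
        ; comm = +ₚ-comm
        }
      ; *-cong     = λ {p} {p′} {q} {q′} p≈p′ q≈q′ → ≈ₚ-trans (*ₚ-congˡ q p≈p′) (*ₚ-congʳ p′ q≈q′)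
      ; *-assoc    = *ₚ-assoc
      ; *-identity = *ₚ-identityˡ , (λ p → ≈ₚ-trans (*ₚ-comm p 1ₚ) (*ₚ-identityˡ p))
      ; distrib    = *ₚ-distribˡ , *ₚ-distribʳ
      }
    ; *-comm = *ₚ-comm
    }

  R[X] : CommutativeRing c ℓ
  R[X] = record { isCommutativeRing = +ₚ-*ₚ-isCommutativeRing }

  X*-cancel : ∀ {p q} → X *ₚ p ≈ₚ X *ₚ q → p ≈ₚ q
  X*-cancel {p} {q} Xp≈Xq .coeff-≈ k = trans (≈-sym (coeff-X* p k)) (trans (coeff-≈ Xp≈Xq (suc k)) (coeff-X* q k))
    where
    coeff-X* : ∀ p k → coeff (X *ₚ p) (suc k) ≈ coeff p k
    coeff-X* p k = trans (coeff-+ (0# ·ₚ p) _ (suc k))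
      (trans (+-cong (trans (coeff-· 0# p (suc k)) (zeroˡ _)) (coeff-≈ (*ₚ-identityˡ p) k)) (+-identityˡ _))

  eval : Carrier → Poly → Carrier
  eval y []      = 0#
  eval y (a ∷ p) = a + y * eval y p

  module _ (y : Carrier) where

    eval-≈[] : ∀ p → p ≈ₚ [] → eval y p ≈ 0#
    eval-≈[] []      _   = refl
    eval-≈[] (a ∷ p) p≈0 = begin
      a + y * eval y p   ≈⟨ +-cong (coeff-≈ p≈0 zero) (*-congˡ (eval-≈[] p (∷-tail-≈[] p≈0))) ⟩
      0# + y * 0#        ≈⟨ trans (+-identityˡ _) (zeroʳ y) ⟩
      0#                 ∎

    eval-cong : ∀ {p q} → p ≈ₚ q → eval y p ≈ eval y q
    eval-cong {[]}    {[]}    _   = refl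
    eval-cong {[]}    {b ∷ q} p≈q = ≈-sym (eval-≈[] (b ∷ q) (≈ₚ-sym p≈q))
    eval-cong {a ∷ p} {[]}    p≈q = eval-≈[] (a ∷ p) p≈q
    eval-cong {a ∷ p} {b ∷ q} p≈q = +-cong (coeff-≈ p≈q zero) (*-congˡ (eval-cong (∷-tail p≈q)))

    eval-+ : ∀ p q → eval y (p +ₚ q) ≈ eval y p + eval y q
    eval-+ []      q       = ≈-sym (+-identityˡ _)
    eval-+ (a ∷ p) []      = ≈-sym (+-identityʳ _)
    eval-+ (a ∷ p) (b ∷ q) = begin
      (a + b) + y * eval y (p +ₚ q)              ≈⟨ +-congˡ (*-congˡ (eval-+ p q)) ⟩
      (a + b) + y * (eval y p + eval y q)
        ≈⟨ solve 5 (λ a b y u v → (a :+ b) :+ y :* (u :+ v) := (a :+ y :* u) :+ (b :+ y :* v)) refl a b y _ _ ⟩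
      (a + y * eval y p) + (b + y * eval y q)    ∎

    eval-neg : ∀ p → eval y (-ₚ p) ≈ - eval y p
    eval-neg []      = ≈-sym -0#≈0#
    eval-neg (a ∷ p) = begin
      - a + y * eval y (-ₚ p)   ≈⟨ +-congˡ (trans (*-congˡ (eval-neg p)) (≈-sym (-‿distribʳ-* _ _))) ⟩
      - a + - (y * eval y p)    ≈⟨ -‿+-comm _ _ ⟩
      - (a + y * eval y p)      ∎

    eval-· : ∀ a p → eval y (a ·ₚ p) ≈ a * eval y p
    eval-· a []      = ≈-sym (zeroʳ a)
    eval-· a (b ∷ p) = begin
      a * b + y * eval y (a ·ₚ p)   ≈⟨ +-congˡ (*-congˡ (eval-· a p)) ⟩
      a * b + y * (a * eval y p)
        ≈⟨ solve 4 (λ a b y u → a :* b :+ y :* (a :* u) := a :* (b :+ y :* u)) refl a b y _ ⟩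
      a * (b + y * eval y p)        ∎

    eval-* : ∀ p q → eval y (p *ₚ q) ≈ eval y p * eval y q
    eval-* []      q = ≈-sym (zeroˡ _)
    eval-* (a ∷ p) q = begin
      eval y (a ·ₚ q +ₚ (0# ∷ p *ₚ q))           ≈⟨ eval-+ (a ·ₚ q) (0# ∷ p *ₚ q) ⟩
      eval y (a ·ₚ q) + (0# + y * eval y (p *ₚ q))
        ≈⟨ +-cong (eval-· a q) (trans (+-identityˡ _) (*-congˡ (eval-* p q))) ⟩
      a * eval y q + y * (eval y p * eval y q)
        ≈⟨ solve 4 (λ a y u v → a :* v :+ y :* (u :* v) := (a :+ y :* u) :* v) refl a y _ _ ⟩
      (a + y * eval y p) * eval y q               ∎

    eval-const : ∀ a → eval y (a ∷ []) ≈ a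
    eval-const a = trans (+-congˡ (zeroʳ y)) (+-identityʳ a)

    eval-X : eval y X ≈ y
    eval-X = trans (+-identityˡ _) (trans (*-congˡ (eval-const 1#)) (*-identityʳ y))

    eval-isRingHomomorphism : IsRingHomomorphism (CommutativeRing.rawRing R[X]) rawRing (eval y)
    eval-isRingHomomorphism = record
      { isSemiringHomomorphism = record
        { isNearSemiringHomomorphism = record
          { +-isMonoidHomomorphism = record
            { isMagmaHomomorphism = record
              { isRelHomomorphism = record { cong = eval-cong }
              ; homo              = eval-+
              }
            ; ε-homo = refl
            }
          ; *-homo = eval-*
          }
        ; 1#-homo = eval-const 1#
        }
      ; -‿homo = eval-neg
      }

module RingHomomorphism {c₁ ℓ₁ c₂ ℓ₂} (R₁ : CommutativeRing c₁ ℓ₁) (R₂ : CommutativeRing c₂ ℓ₂)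
  {h : CommutativeRing.Carrier R₁ → CommutativeRing.Carrier R₂}
  (h-isHom : IsRingHomomorphism (CommutativeRing.rawRing R₁) (CommutativeRing.rawRing R₂) h) where
  private
    module R₁ = CommutativeRing R₁
    module M₁ = Mat R₁
    module D₁ = Determinant R₁
  open CommutativeRing R₂ hiding (zero) renaming (sym to ≈-sym)
  open Mat R₂
  open Determinant R₂
  open IsRingHomomorphism h-isHom
  open import Relation.Binary.Reasoning.Setoid setoid

  sum-homo : ∀ {k} (f : Fin k → R₁.Carrier) → h (D₁.sum f) ≈ sum (h ∘ f)
  sum-homo {zero}  f = 0#-homo
  sum-homo {suc k} f = trans (+-homo _ _) (+-congˡ (sum-homo (f ∘ suc)))

  sign-homo : ∀ n → h (M₁.sign n) ≈ sign n
  sign-homo zero    = 1#-homo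
  sign-homo (suc n) = trans (-‿homo _) (-‿cong (sign-homo n))

  I-homo : ∀ {k} (i j : Fin k) → h (M₁.I i j) ≈ I i j
  I-homo i j with i ≟ j
  ... | yes _ = 1#-homo
  ... | no _  = 0#-homo

  det-homo : ∀ k (M : M₁.Matrix k) → h (M₁.det k M) ≈ det k (λ i j → h (M i j))
  det-homo zero    M = 1#-homo
  det-homo (suc k) M = begin
    h (M₁.det (suc k) M)                  ≈⟨ ⟦⟧-cong (D₁.det-laplace M) ⟩
    h (D₁.sum (D₁.laplaceTerm M))         ≈⟨ sum-homo (D₁.laplaceTerm M) ⟩
    sum (h ∘ D₁.laplaceTerm M)            ≈⟨ sum-cong (h ∘ D₁.laplaceTerm M) (laplaceTerm hM) term-homo ⟩
    sum (laplaceTerm hM)                  ≈⟨ det-laplace hM ⟨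
    det (suc k) hM                        ∎
    where
    hM : Matrix (suc k)
    hM i j = h (M i j)
    term-homo : ∀ j → h (D₁.laplaceTerm M j) ≈ laplaceTerm hM j
    term-homo j = trans (*-homo _ _)
                        (*-cong (trans (*-homo _ _) (*-congʳ (sign-homo (toℕ j)))) (det-homo k (D₁.minor j M)))

  *ᴹ-homo : ∀ {n m p} (X : Fin n → Fin m → R₁.Carrier) (Y : Fin m → Fin p → R₁.Carrier) i j →
            h ((X D₁.*ᴹ Y) i j) ≈ ((λ i l → h (X i l)) *ᴹ (λ l j → h (Y l j))) i j
  *ᴹ-homo X Y i j = trans (sum-homo (λ l → X i l R₁.* Y l j)) (sum-cong _ _ λ l → *-homo (X i l) (Y l j))

  charPoly-homo : ∀ {k} (M : M₁.Matrix k) x → h (M₁.charPoly M x) ≈ charPoly (λ i j → h (M i j)) (h x)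
  charPoly-homo {k} M x = trans (det-homo k (λ i j → x R₁.* M₁.I i j R₁.+ R₁.- M i j)) (det-cong {k} λ i j →
    trans (+-homo _ _) (+-cong (trans (*-homo _ _) (*-congˡ (I-homo i j))) (-‿homo _)))

module CharPolyOfProducts {c ℓ} (R : CommutativeRing c ℓ) where
  open CommutativeRing R hiding (zero) renaming (sym to ≈-sym)
  open Mat R
  open Determinant R
  open Polynomial R using (Poly; R[X]; X; _*ₚ_; _≈ₚ_; ≈ₚ-sym; ≈ₚ-trans; *ₚ-assoc; *ₚ-identityˡ; X*-cancel;
                           eval; eval-cong; eval-*; eval-const; eval-X; eval-isRingHomomorphism)
  private
    module S  = CommutativeRing R[X]
    module MS = Mat R[X]
    module DS = Determinant R[X]

  constᴹ : ∀ {n m} → (Fin n → Fin m → Carrier) → Fin n → Fin m → Poly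
  constᴹ A i j = A i j ∷ []

  pow-X*-cancel : ∀ k {p q} → MS.pow X k *ₚ p ≈ₚ MS.pow X k *ₚ q → p ≈ₚ q
  pow-X*-cancel zero    {p} {q} eq = ≈ₚ-trans (≈ₚ-sym (*ₚ-identityˡ p)) (≈ₚ-trans eq (*ₚ-identityˡ q))
  pow-X*-cancel (suc k) {p} {q} eq = pow-X*-cancel k (X*-cancel
    (≈ₚ-trans (≈ₚ-sym (*ₚ-assoc X (MS.pow X k) p)) (≈ₚ-trans eq (*ₚ-assoc X (MS.pow X k) q))))

  charPolyX-*ᴹ-comm : ∀ {n m} (A : Fin n → Fin m → Poly) (B : Fin m → Fin n → Poly) → n ≤ m →
                      MS.charPoly (B DS.*ᴹ A) X ≈ₚ MS.pow X (m ∸ n) *ₚ MS.charPoly (A DS.*ᴹ B) X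
  charPolyX-*ᴹ-comm {n} {m} A B n≤m = ≈ₚ-sym (pow-X*-cancel n (begin
    MS.pow X n *ₚ (MS.pow X d *ₚ χAB)   ≈⟨ *ₚ-assoc (MS.pow X n) (MS.pow X d) χAB ⟨
    MS.pow X n *ₚ MS.pow X d *ₚ χAB     ≈⟨ S.*-congʳ (DS.pow-+ X n d) ⟨
    MS.pow X (n ℕ.+ d) *ₚ χAB           ≡⟨ ≡.cong (λ k → MS.pow X k *ₚ χAB) (ℕ.m+[n∸m]≡n n≤m) ⟩
    MS.pow X m *ₚ χAB                   ≈⟨ DS.charPoly-*ᴹ-sylvester A B X ⟩
    MS.pow X n *ₚ MS.charPoly (B DS.*ᴹ A) X ∎))
    where
    open import Relation.Binary.Reasoning.Setoid S.setoid
    d = m ∸ n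
    χAB = MS.charPoly (A DS.*ᴹ B) X

  module _ (y : Carrier) where
    open RingHomomorphism R[X] R (eval-isRingHomomorphism y)

    eval-pow-X : ∀ k → eval y (MS.pow X k) ≈ pow y k
    eval-pow-X zero    = eval-const y 1#
    eval-pow-X (suc k) = trans (eval-* y X (MS.pow X k)) (*-cong (eval-X y) (eval-pow-X k))

    eval-charPoly-*ᴹ : ∀ {n m} (A : Fin n → Fin m → Carrier) (B : Fin m → Fin n → Carrier) →
                       eval y (MS.charPoly (constᴹ A DS.*ᴹ constᴹ B) X) ≈ charPoly (A *ᴹ B) y
    eval-charPoly-*ᴹ A B = trans (charPoly-homo (constᴹ A DS.*ᴹ constᴹ B) X) (charPoly-cong (λ i j →
      trans (*ᴹ-homo (constᴹ A) (constᴹ B) i j)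
            (sum-cong _ _ λ l → *-cong (eval-const y (A i l)) (eval-const y (B l j)))) (eval-X y))

  charPoly-*ᴹ-comm : ∀ {n m} (A : Fin n → Fin m → Carrier) (B : Fin m → Fin n → Carrier) y → n ≤ m →
                     charPoly (B *ᴹ A) y ≈ pow y (m ∸ n) * charPoly (A *ᴹ B) y
  charPoly-*ᴹ-comm {n} {m} A B y n≤m = begin
    charPoly (B *ᴹ A) y                              ≈⟨ eval-charPoly-*ᴹ y B A ⟨
    eval y (MS.charPoly (B̂ DS.*ᴹ Â) X)               ≈⟨ eval-cong y (charPolyX-*ᴹ-comm Â B̂ n≤m) ⟩
    eval y (MS.pow X (m ∸ n) *ₚ χAB)                 ≈⟨ eval-* y (MS.pow X (m ∸ n)) χAB ⟩
    eval y (MS.pow X (m ∸ n)) * eval y χAB           ≈⟨ *-cong (eval-pow-X y (m ∸ n)) (eval-charPoly-*ᴹ y A B) ⟩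
    pow y (m ∸ n) * charPoly (A *ᴹ B) y              ∎
    where
    open import Relation.Binary.Reasoning.Setoid setoid
    Â = constᴹ A
    B̂ = constᴹ B
    χAB = MS.charPoly (Â DS.*ᴹ B̂) X

module IncidenceMatrix {c ℓ} (R : CommutativeRing c ℓ) {n m} (G : SimpleGraph n) (E : EdgeEnumeration G m) where
  import Data.Integer as ℤ
  open CommutativeRing R hiding (zero) renaming (sym to ≈-sym)
  open Mat R
  open Determinant R
  open IntegerCoefficientSolver R using (solve; _:=_; _:+_; _:*_; :-_; con)
  open import Algebra.Properties.CommutativeSemigroup *-commutativeSemigroup using (x∙yz≈y∙xz)
  open import Relation.Binary.Reasoning.Setoid setoid

  end₁ end₂ : Fin m → Fin n
  end₁ k = proj₁ (edge E k)
  end₂ k = proj₂ (edge E k)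

  incidence : Fin n → Fin m → Carrier
  incidence v k = I v (end₁ k) + I v (end₂ k)

  incidenceᵀ : Fin m → Fin n → Carrier
  incidenceᵀ k v = incidence v k

  edgeCount : Fin n → Fin n → Carrier
  edgeCount a b = sum (λ k → I a (end₁ k) * I b (end₂ k))

  edgeCount-ordered : ∀ {a b} → a Fin.< b → edgeCount a b ≈ B→R (adj G a b)
  edgeCount-ordered {a} {b} a<b with adj G a b in adj≡
  ... | true  = trans (sum-cong _ (λ k → I k₀ k * 1#) term) (sum-I* k₀ (λ _ → 1#))
    where
    k₀ = proj₁ (surjective E a b a<b adj≡)
    term : ∀ k → I a (end₁ k) * I b (end₂ k) ≈ I k₀ k * 1#
    term k with k₀ ≟ k
    ... | yes ≡.refl rewrite proj₂ (surjective E a b a<b adj≡) = *-cong (I-diag a) (I-diag b)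
    ... | no k₀≢k with a ≟ end₁ k | b ≟ end₂ k
    ...   | yes ≡.refl | yes ≡.refl = contradiction (injective E (proj₂ (surjective E a b a<b adj≡))) k₀≢k
    ...   | yes _      | no _       = trans (zeroʳ _) (≈-sym (zeroˡ _))
    ...   | no _       | _          = trans (zeroˡ _) (≈-sym (zeroˡ _))
  ... | false = sum-zero _ term
    where
    term : ∀ k → I a (end₁ k) * I b (end₂ k) ≈ 0#
    term k with a ≟ end₁ k | b ≟ end₂ k
    ... | yes ≡.refl | yes ≡.refl = contradiction (≡.trans (≡.sym adj≡) (isEdge E k)) λ ()
    ... | yes _      | no _       = zeroʳ _
    ... | no _       | _          = zeroˡ _

  edgeCount-unordered : ∀ {a b} → ¬ a Fin.< b → edgeCount a b ≈ 0#
  edgeCount-unordered {a} {b} a≮b = sum-zero _ term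
    where
    term : ∀ k → I a (end₁ k) * I b (end₂ k) ≈ 0#
    term k with a ≟ end₁ k | b ≟ end₂ k
    ... | yes ≡.refl | yes ≡.refl = contradiction (ordered E k) a≮b
    ... | yes _      | no _       = zeroʳ _
    ... | no _       | _          = zeroˡ _

  edgeCount-symmetrised : ∀ a b → edgeCount a b + edgeCount b a ≈ B→R (adj G a b)
  edgeCount-symmetrised a b with Fin.<-cmp a b
  ... | tri< a<b _ b≮a = trans (+-cong (edgeCount-ordered a<b) (edgeCount-unordered b≮a)) (+-identityʳ _)
  ... | tri≈ a≮b ≡.refl _ = trans (+-cong (edgeCount-unordered a≮b) (edgeCount-unordered a≮b))
                                (trans (+-identityˡ 0#) (reflexive (≡.cong B→R (≡.sym (irrefl G a)))))
  ... | tri> a≮b _ b<a = trans (+-cong (edgeCount-unordered a≮b) (edgeCount-ordered b<a))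
                              (trans (+-identityˡ _) (reflexive (≡.cong B→R (sym G b a))))

  sum-end₁ : ∀ v → sum (λ k → I v (end₁ k)) ≈ sum (λ b → edgeCount v b)
  sum-end₁ v = begin
    sum (λ k → I v (end₁ k))
      ≈⟨ sum-cong _ (λ k → I v (end₁ k) * sum (λ b → I b (end₂ k)))
          (λ k → ≈-sym (trans (*-congˡ (sum-I-col (end₂ k))) (*-identityʳ _))) ⟩
    sum (λ k → I v (end₁ k) * sum (λ b → I b (end₂ k)))
      ≈⟨ sum-cong _ _ (λ k → *-distribˡ-sum (I v (end₁ k)) (λ b → I b (end₂ k))) ⟩
    sum (λ k → sum (λ b → I v (end₁ k) * I b (end₂ k)))   ≈⟨ ∑-comm (λ k b → I v (end₁ k) * I b (end₂ k)) ⟩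
    sum (λ b → edgeCount v b)                             ∎

  sum-end₂ : ∀ v → sum (λ k → I v (end₂ k)) ≈ sum (λ a → edgeCount a v)
  sum-end₂ v = begin
    sum (λ k → I v (end₂ k))
      ≈⟨ sum-cong _ (λ k → sum (λ a → I a (end₁ k)) * I v (end₂ k))
          (λ k → ≈-sym (trans (*-congʳ (sum-I-col (end₁ k))) (*-identityˡ _))) ⟩
    sum (λ k → sum (λ a → I a (end₁ k)) * I v (end₂ k))
      ≈⟨ sum-cong _ _ (λ k → *-distribʳ-sum (I v (end₂ k)) (λ a → I a (end₁ k))) ⟩
    sum (λ k → sum (λ a → I a (end₁ k) * I v (end₂ k)))   ≈⟨ ∑-comm (λ k a → I a (end₁ k) * I v (end₂ k)) ⟩
    sum (λ a → edgeCount a v)                             ∎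

  incidence-rowSum : ∀ v → sum (incidence v) ≈ ℕ→R (degreeOf (adj G) v)
  incidence-rowSum v = begin
    sum (incidence v)
      ≈⟨ ∑-distrib-+ (λ k → I v (end₁ k)) (λ k → I v (end₂ k)) ⟩
    sum (λ k → I v (end₁ k)) + sum (λ k → I v (end₂ k))    ≈⟨ +-cong (sum-end₁ v) (sum-end₂ v) ⟩
    sum (λ b → edgeCount v b) + sum (λ b → edgeCount b v)
      ≈⟨ ∑-distrib-+ (edgeCount v) (λ b → edgeCount b v) ⟨
    sum (λ b → edgeCount v b + edgeCount b v)              ≈⟨ sum-cong _ _ (edgeCount-symmetrised v) ⟩
    sum (λ b → B→R (adj G v b))                            ≈⟨ ℕ→R-count (adj G v) ⟨
    ℕ→R (degreeOf (adj G) v)                               ∎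

  incidence*incidenceᵀ : ∀ i j → (incidence *ᴹ incidenceᵀ) i j ≈ Q (adj G) i j
  incidence*incidenceᵀ i j = begin
    sum (λ k → incidence i k * incidence j k)
      ≈⟨ sum-cong _ (λ k → I i j * incidence i k + cross k) expand ⟩
    sum (λ k → I i j * incidence i k + cross k)
      ≈⟨ ∑-distrib-+ (λ k → I i j * incidence i k) cross ⟩
    sum (λ k → I i j * incidence i k) + sum cross
      ≈⟨ +-cong (*-distribˡ-sum (I i j) (incidence i))
                (≈-sym (∑-distrib-+ (λ k → I i (end₁ k) * I j (end₂ k)) (λ k → I j (end₁ k) * I i (end₂ k)))) ⟨
    I i j * sum (incidence i) + (edgeCount i j + edgeCount j i)
      ≈⟨ +-cong (*-congˡ (incidence-rowSum i)) (edgeCount-symmetrised i j) ⟩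
    I i j * ℕ→R (degreeOf (adj G) i) + B→R (adj G i j)     ∎
    where
    cross : Fin m → Carrier
    cross k = I i (end₁ k) * I j (end₂ k) + I j (end₁ k) * I i (end₂ k)
    expand : ∀ k → incidence i k * incidence j k ≈ I i j * incidence i k + cross k
    expand k = begin
      (I i a + I i b) * (I j a + I j b)
        ≈⟨ solve 4 (λ x y u w → (x :+ y) :* (u :+ w) := (x :* u :+ y :* w) :+ (x :* w :+ u :* y))
                   refl (I i a) (I i b) (I j a) (I j b) ⟩
      (I i a * I j a + I i b * I j b) + (I i a * I j b + I j a * I i b)
        ≈⟨ +-congʳ (trans (+-cong (I-*-I i j a) (I-*-I i j b)) (≈-sym (distribˡ _ _ _))) ⟩
      I i j * (I i a + I i b) + (I i a * I j b + I j a * I i b) ∎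
      where
      a = end₁ k
      b = end₂ k

  sum-common-endpoints : ∀ (a b c d : Fin n) →
                         sum (λ v → (I v a + I v b) * (I v c + I v d)) ≈ (I a c + I a d) + (I b c + I b d)
  sum-common-endpoints a b c d = begin
    sum (λ v → (I v a + I v b) * (I v c + I v d))
      ≈⟨ sum-cong _ (λ v → (I v a * I v c + I v a * I v d) + (I v b * I v c + I v b * I v d)) (λ v →
           solve 4 (λ x y u w → (x :+ y) :* (u :+ w) := (x :* u :+ x :* w) :+ (y :* u :+ y :* w))
                   refl (I v a) (I v b) (I v c) (I v d)) ⟩
    sum (λ v → (I v a * I v c + I v a * I v d) + (I v b * I v c + I v b * I v d))
      ≈⟨ ∑-distrib-+ (λ v → I v a * I v c + I v a * I v d) (λ v → I v b * I v c + I v b * I v d) ⟩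
    sum (λ v → I v a * I v c + I v a * I v d) + sum (λ v → I v b * I v c + I v b * I v d)
      ≈⟨ +-cong (∑-distrib-+ (λ v → I v a * I v c) (λ v → I v a * I v d))
                (∑-distrib-+ (λ v → I v b * I v c) (λ v → I v b * I v d)) ⟩
    (sum (λ v → I v a * I v c) + sum (λ v → I v a * I v d))
      + (sum (λ v → I v b * I v c) + sum (λ v → I v b * I v d))
      ≈⟨ +-cong (+-cong (sum-I-*-I a c) (sum-I-*-I a d)) (+-cong (sum-I-*-I b c) (sum-I-*-I b d)) ⟩
    (I a c + I a d) + (I b c + I b d)                                                     ∎

  shared-endpoints : ∀ {a b c d : Fin n} → a Fin.< b → c Fin.< d → (a , b) ≢ (c , d) →
                     (I a c + I a d) + (I b c + I b d) ≈ B→R (shares (a , b) (c , d))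
  shared-endpoints {a} {b} {c} {d} a<b c<d ab≢cd with a ≟ c | a ≟ d | b ≟ c | b ≟ d
  ... | yes ≡.refl | yes ≡.refl | _          | _          = contradiction c<d (Fin.<-irrefl ≡.refl)
  ... | yes ≡.refl | no _       | yes ≡.refl | _          = contradiction a<b (Fin.<-irrefl ≡.refl)
  ... | yes ≡.refl | no _       | no _       | yes ≡.refl = contradiction ≡.refl ab≢cd
  ... | yes ≡.refl | no _       | no _       | no _       = trans (+-cong (+-identityʳ 1#) (+-identityʳ 0#)) (+-identityʳ 1#)
  ... | no _       | yes ≡.refl | yes ≡.refl | _          = contradiction (Fin.<-trans a<b c<d) (Fin.<-irrefl ≡.refl)
  ... | no _       | yes ≡.refl | no _       | yes ≡.refl = contradiction a<b (Fin.<-irrefl ≡.refl)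
  ... | no _       | yes ≡.refl | no _       | no _       = trans (+-cong (+-identityˡ 1#) (+-identityʳ 0#)) (+-identityʳ 1#)
  ... | no _       | no _       | yes ≡.refl | yes ≡.refl = contradiction c<d (Fin.<-irrefl ≡.refl)
  ... | no _       | no _       | yes ≡.refl | no _       = trans (+-cong (+-identityʳ 0#) (+-identityʳ 1#)) (+-identityˡ 1#)
  ... | no _       | no _       | no _       | yes ≡.refl = trans (+-cong (+-identityʳ 0#) (+-identityˡ 1#)) (+-identityˡ 1#)
  ... | no _       | no _       | no _       | no _       = trans (+-cong (+-identityʳ 0#) (+-identityʳ 0#)) (+-identityʳ 0#)

  incidenceᵀ*incidence : ∀ k k′ → (incidenceᵀ *ᴹ incidence) k k′ ≈ B→R (lineAdj E k k′) + ℕ→R 2 * I k k′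
  incidenceᵀ*incidence k k′ with k ≟ k′
  ... | yes ≡.refl = begin
    sum (λ v → incidence v k * incidence v k)          ≈⟨ sum-common-endpoints a b a b ⟩
    (I a a + I a b) + (I b a + I b b)
      ≈⟨ +-cong (+-cong (I-diag a) (I-offDiag a≢b)) (+-cong (I-offDiag (a≢b ∘ ≡.sym)) (I-diag b)) ⟩
    (1# + 0#) + (0# + 1#)
      ≈⟨ +-cong (+-identityʳ 1#) (trans (+-identityˡ 1#) (≈-sym (+-identityʳ 1#))) ⟩
    1# + (1# + 0#)                                     ≈⟨ trans (+-identityˡ _) (*-identityʳ _) ⟨
    0# + ℕ→R 2 * 1#                                    ∎
    where
    a = end₁ k
    b = end₂ k
    a≢b : a ≢ b
    a≢b a≡b = Fin.<-irrefl a≡b (ordered E k)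
  ... | no k≢k′ = begin
    sum (λ v → incidence v k * incidence v k′)
      ≈⟨ sum-common-endpoints (end₁ k) (end₂ k) (end₁ k′) (end₂ k′) ⟩
    (I (end₁ k) (end₁ k′) + I (end₁ k) (end₂ k′)) + (I (end₂ k) (end₁ k′) + I (end₂ k) (end₂ k′))
      ≈⟨ shared-endpoints (ordered E k) (ordered E k′) (k≢k′ ∘ injective E) ⟩
    B→R (shares (edge E k) (edge E k′))                ≈⟨ trans (+-congˡ (zeroʳ _)) (+-identityʳ _) ⟨
    B→R (shares (edge E k) (edge E k′)) + ℕ→R 2 * 0#   ∎

  lineGraph-degree : ∀ {r} → IsRegular G r → ∀ k → ℕ→R (degreeOf (lineAdj E) k) + ℕ→R 2 ≈ ℕ→R (2 ℕ.* r)
  lineGraph-degree {r} regular k = begin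
    ℕ→R (count (lineAdj E k)) + ℕ→R 2
      ≈⟨ +-cong (ℕ→R-count (lineAdj E k)) (≈-sym (trans (*-congˡ (sum-I* k (λ _ → 1#))) (*-identityʳ _))) ⟩
    sum (λ k′ → B→R (lineAdj E k k′)) + ℕ→R 2 * sum (λ k′ → I k k′ * 1#)
      ≈⟨ +-congˡ (trans (*-distribˡ-sum (ℕ→R 2) (λ k′ → I k k′ * 1#))
                        (sum-cong _ (λ k′ → ℕ→R 2 * I k k′) λ k′ → *-congˡ (*-identityʳ _))) ⟩
    sum (λ k′ → B→R (lineAdj E k k′)) + sum (λ k′ → ℕ→R 2 * I k k′)
      ≈⟨ ∑-distrib-+ (λ k′ → B→R (lineAdj E k k′)) (λ k′ → ℕ→R 2 * I k k′) ⟨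
    sum (λ k′ → B→R (lineAdj E k k′) + ℕ→R 2 * I k k′)
      ≈⟨ sum-cong _ (λ k′ → sum (λ v → incidence v k * incidence v k′)) (λ k′ → ≈-sym (incidenceᵀ*incidence k k′)) ⟩
    sum (λ k′ → sum (λ v → incidence v k * incidence v k′))
      ≈⟨ ∑-comm (λ v k′ → incidence v k * incidence v k′) ⟨
    sum (λ v → sum (λ k′ → incidence v k * incidence v k′))
      ≈⟨ sum-cong _ (λ v → incidence v k * ℕ→R r) (λ v → trans (≈-sym (*-distribˡ-sum (incidence v k) (incidence v)))
                   (*-congˡ (trans (incidence-rowSum v) (reflexive (≡.cong ℕ→R (regular v)))))) ⟩
    sum (λ v → incidence v k * ℕ→R r)                     ≈⟨ *-distribʳ-sum (ℕ→R r) (λ v → incidence v k) ⟨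
    sum (λ v → incidence v k) * ℕ→R r                     ≈⟨ *-congʳ endpoints ⟩
    ℕ→R 2 * ℕ→R r                                         ≈⟨ ℕ→R-* 2 r ⟨
    ℕ→R (2 ℕ.* r)                                         ∎
    where
    endpoints : sum (λ v → incidence v k) ≈ ℕ→R 2
    endpoints = begin
      sum (λ v → I v (end₁ k) + I v (end₂ k))
        ≈⟨ ∑-distrib-+ (λ v → I v (end₁ k)) (λ v → I v (end₂ k)) ⟩
      sum (λ v → I v (end₁ k)) + sum (λ v → I v (end₂ k))
        ≈⟨ +-cong (sum-I-col (end₁ k)) (trans (sum-I-col (end₂ k)) (≈-sym (+-identityʳ 1#))) ⟩
      1# + (1# + 0#)                                       ∎

  scaledIncidenceᵀ : Carrier → Fin m → Fin n → Carrier
  scaledIncidenceᵀ β k v = β * incidence v k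

  charPoly-lineGraph : ∀ {r} → IsRegular G r → ∀ α x →
                       charPoly (Aα α (lineAdj E)) x
                         ≈ charPoly (scaledIncidenceᵀ (1# + - α) *ᴹ incidence) (x + - (ℕ→R (2 ℕ.* r) * α) + ℕ→R 2)
  charPoly-lineGraph {r} regular α x = det-cong λ k k′ → begin
    x * I k k′ + - (α * (I k k′ * ℕ→R (degreeOf (lineAdj E) k)) + (1# + - α) * B→R (lineAdj E k k′))
      ≈⟨ solve 6 (λ x δ α d a t → x :* δ :+ :- (α :* (δ :* d) :+ (con (ℤ.+ 1) :+ :- α) :* a)
                                := (x :+ :- ((d :+ t) :* α) :+ t) :* δ :+ :- ((con (ℤ.+ 1) :+ :- α) :* (a :+ t :* δ)))
                 refl x (I k k′) α (ℕ→R (degreeOf (lineAdj E) k)) (B→R (lineAdj E k k′)) (ℕ→R 2) ⟩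
    (x + - ((ℕ→R (degreeOf (lineAdj E) k) + ℕ→R 2) * α) + ℕ→R 2) * I k k′
      + - ((1# + - α) * (B→R (lineAdj E k k′) + ℕ→R 2 * I k k′))
      ≈⟨ +-cong (*-congʳ (+-congʳ (+-congˡ (-‿cong (*-congʳ (lineGraph-degree regular k))))))
                (-‿cong (*-congˡ (≈-sym (incidenceᵀ*incidence k k′)))) ⟩
    (x + - (ℕ→R (2 ℕ.* r) * α) + ℕ→R 2) * I k k′ + - ((1# + - α) * sum (λ v → incidence v k * incidence v k′))
      ≈⟨ +-congˡ (-‿cong (trans (*-distribˡ-sum (1# + - α) (λ v → incidence v k * incidence v k′))
                                (sum-cong _ (λ v → (1# + - α) * incidence v k * incidence v k′) λ v →
                                  ≈-sym (*-assoc _ _ _)))) ⟩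
    (x + - (ℕ→R (2 ℕ.* r) * α) + ℕ→R 2) * I k k′ + - (scaledIncidenceᵀ (1# + - α) *ᴹ incidence) k k′ ∎

  charPoly-incidence*scaledIncidenceᵀ : ∀ β u y → u * β ≈ 1# →
                                        charPoly (incidence *ᴹ scaledIncidenceᵀ β) y
                                          ≈ pow β n * charPoly (Q (adj G)) (y * u)
  charPoly-incidence*scaledIncidenceᵀ β u y u*β≈1 = trans (det-cong entry) (det-scale n β _)
    where
    entry : ∀ i j → y * I i j + - (incidence *ᴹ scaledIncidenceᵀ β) i j
                      ≈ β * ((y * u) * I i j + - Q (adj G) i j)
    entry i j = begin
      y * I i j + - sum (λ k → incidence i k * (β * incidence j k))
        ≈⟨ +-cong (≈-sym (trans (*-congʳ u*β≈1) (*-identityˡ _)))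
                  (-‿cong (trans (sum-cong _ (λ k → β * (incidence i k * incidence j k)) λ k → x∙yz≈y∙xz _ _ _)
                                 (≈-sym (*-distribˡ-sum β (λ k → incidence i k * incidence j k))))) ⟩
      (u * β) * (y * I i j) + - (β * sum (λ k → incidence i k * incidence j k))
        ≈⟨ +-congˡ (-‿cong (*-congˡ (incidence*incidenceᵀ i j))) ⟩
      (u * β) * (y * I i j) + - (β * Q (adj G) i j)
        ≈⟨ solve 5 (λ u β y δ q → (u :* β) :* (y :* δ) :+ :- (β :* q) := β :* ((y :* u) :* δ :+ :- q))
                   refl u β y (I i j) (Q (adj G) i j) ⟩
      β * ((y * u) * I i j + - Q (adj G) i j) ∎

corollary5 : ∀ {c ℓ} (R : CommutativeRing c ℓ) →
    let open CommutativeRing R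
        open Mat R
    in ∀ {n m r : ℕ} (G : SimpleGraph n) (E : EdgeEnumeration G m) →
       IsRegular G r → m ≢ 0 →
       ∀ (α u : Carrier) → u * (1# + - α) ≈ 1# →
       ∀ (x : Carrier) →
       (n ≤ m →
          charPoly (Aα α (lineAdj E)) x
            ≈ pow (x + - (ℕ→R (2 Data.Nat.* r) * α) + ℕ→R 2) (m ∸ n)
              * pow (1# + - α) n
              * charPoly (Q (adj G)) ((x + - (ℕ→R (2 Data.Nat.* r) * α) + ℕ→R 2) * u))
       × (m < n →
          pow (x + - (ℕ→R (2 Data.Nat.* r) * α) + ℕ→R 2) (n ∸ m)
            * charPoly (Aα α (lineAdj E)) x
            ≈ pow (1# + - α) n
              * charPoly (Q (adj G)) ((x + - (ℕ→R (2 Data.Nat.* r) * α) + ℕ→R 2) * u))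
corollary5 R {n} {m} {r} G E regular _ α u u*β≈1 x = n≤m-case , m<n-case
  where
  open CommutativeRing R
  open Mat R
  open Determinant R using (_*ᴹ_)
  open IncidenceMatrix R G E
    using (incidence; scaledIncidenceᵀ; charPoly-lineGraph; charPoly-incidence*scaledIncidenceᵀ)
  open CharPolyOfProducts R using (charPoly-*ᴹ-comm)
  open import Relation.Binary.Reasoning.Setoid setoid

  β = 1# + - α
  y = x + - (ℕ→R (2 ℕ.* r) * α) + ℕ→R 2
  βBᵀ = scaledIncidenceᵀ β

  n≤m-case : n ≤ m → charPoly (Aα α (lineAdj E)) x ≈ pow y (m ∸ n) * pow β n * charPoly (Q (adj G)) (y * u)
  n≤m-case n≤m = begin
    charPoly (Aα α (lineAdj E)) x                             ≈⟨ charPoly-lineGraph regular α x ⟩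
    charPoly (βBᵀ *ᴹ incidence) y                             ≈⟨ charPoly-*ᴹ-comm incidence βBᵀ y n≤m ⟩
    pow y (m ∸ n) * charPoly (incidence *ᴹ βBᵀ) y
      ≈⟨ *-congˡ (charPoly-incidence*scaledIncidenceᵀ β u y u*β≈1) ⟩
    pow y (m ∸ n) * (pow β n * charPoly (Q (adj G)) (y * u))  ≈⟨ *-assoc _ _ _ ⟨
    pow y (m ∸ n) * pow β n * charPoly (Q (adj G)) (y * u)    ∎

  m<n-case : m < n → pow y (n ∸ m) * charPoly (Aα α (lineAdj E)) x ≈ pow β n * charPoly (Q (adj G)) (y * u)
  m<n-case m<n = begin
    pow y (n ∸ m) * charPoly (Aα α (lineAdj E)) x  ≈⟨ *-congˡ (charPoly-lineGraph regular α x) ⟩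
    pow y (n ∸ m) * charPoly (βBᵀ *ᴹ incidence) y  ≈⟨ charPoly-*ᴹ-comm βBᵀ incidence y (ℕ.<⇒≤ m<n) ⟨
    charPoly (incidence *ᴹ βBᵀ) y                  ≈⟨ charPoly-incidence*scaledIncidenceᵀ β u y u*β≈1 ⟩
    pow β n * charPoly (Q (adj G)) (y * u)         ∎
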